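{- Let $k,n$ be positive integers, $\lambda,\mu\in\mathcal{A}_{k,n}$ and $\nu\in\mathcal{P}_k^+$. Let $\check\nu\in\mathcal{A}_{k,n}$ be the unique point of the orbit $\nu\hat S_k$ lying in $\mathcal{A}_{k,n}$. Then $$N^\lambda_{\mu\nu}=N^\lambda_{\mu\check\nu}\binom{m_n(\check\nu)}{m_0(\nu),\,m_n(\nu),\,m_{2n}(\nu),\dots}\prod_{i=1}^{n-1}\binom{m_i(\check\nu)}{m_i(\nu),\,m_{i+n}(\nu),\,m_{i+2n}(\nu),\dots},$$ where $m_j(\rho)$ denotes the number of parts of $\rho$ equal to $j$ and the brackets are multinomial coefficients.
   Context: $\mathcal{P}_k^+=\{\nu\in\mathbb{Z}^k:\nu_1\ge\dots\ge\nu_k\ge0\}$. $\mathcal{P}_{k,n}$ is the set of functions $\rho:\mathbb{Z}\to\mathbb{Z}$ with $\rho_{i+k}=\rho_i-n$; each vector in $\mathbb{Z}^k$ extends uniquely to such a function. $\mathcal{A}_{k,n}=\{\rho\in\mathcal{P}_{k,n}:n\ge\rho_1\ge\dots\ge\rho_k>0\}$. The extended affine symmetric group $\hat S_k$ is the group of bijections $\hat w:\mathbb{Z}\to\mathbb{Z}$ with $\hat w(m+k)=\hat w(m)+k$ for all $m$; it acts on $\mathcal{P}_{k,n}$ on the right by $(\rho\circ\hat w)_i=\rho_{\hat w(i)}$ (the level-$n$ action), and $\mathcal{A}_{k,n}$ is a fundamental domain. For $\rho\in\mathbb{Z}^k$, $S_\rho\subset S_k$ is its stabiliser under $\rho\mapsto\rho\circ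 w=(\rho_{w(1)},\dots,\rho_{w(k)})$ and $S^\rho$ the set of minimal-length representatives of $S_\rho\backslash S_k$. For $\lambda,\mu\in\mathcal{A}_{k,n}$ and $\nu\in\mathcal{P}_k^+$, $N^\lambda_{\mu\nu}$ is the number of pairs $(w,w')\in S^\mu\times S^\nu$ for which there exists $\alpha\in\mathbb{Z}^k$ with $\mu_{w(i)}+\nu_{w'(i)}=\lambda_i+n\alpha_i$ for all $i\in[k]$ (equivalently, $\mu\circ w+\nu\circ w'=\lambda\circ y^\alpha$ with $\sum\alpha_i=(|\mu|+|\nu|-|\lambda|)/n$, $y^\alpha$ the weight-lattice translations in $\hat S_k$); these are the coefficients of $h_\nu$ in the expansion of the cylindric complete symmetric function $h_{\lambda/d/\mu}$ with $|\nu|=nd+|\lambda|-|\mu|$. -}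

module Defs where

open import Data.Nat using (ℕ; zero; suc; _+_; _*_; _∸_; _≤_; _<_; NonZero; _≡ᵇ_; _≤ᵇ_; _<ᵇ_; _%_)
open import Data.Nat.Combinatorics using (_C_)
open import Data.Integer as ℤ using (ℤ; +_)
open import Data.Integer.DivMod using (_%ℕ_; _/ℕ_; n%ℕd<d)
open import Data.Fin using (Fin; toℕ; fromℕ<)
open import Data.Fin.Properties using () renaming (_≟_ to _≟ᶠ_)
open import Data.Vec using (Vec; []; _∷_; lookup)
open import Data.List using (List; []; _∷_; map; concatMap; filter; length; foldr; upTo; cartesianProduct)
open import Data.Nat.ListAction using (product)
open import Data.List as L using (allFin)
open import Data.Bool using (Bool; true; false; _∧_; _∨_; not; if_then_else_)
open import Data.Product using (Σ; _×_; _,_; proj₁; proj₂; ∃)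
open import Relation.Binary.PropositionalEquality using (_≡_)
open import Relation.Nullary.Decidable using (⌊_⌋)

-- Vectors in ℕ^k / ℤ^k are functions Fin k → ℕ (index i : Fin k is the
-- paper's index i+1).

Vecℕ : ℕ → Set
Vecℕ k = Fin k → ℕ

Decreasing : {k : ℕ} → Vecℕ k → Set
Decreasing {k} ρ = (i j : Fin k) → toℕ i ≤ toℕ j → ρ j ≤ ρ i

-- 𝒫_k^+  (entries are natural numbers, hence ≥ 0)
InPplus : (k : ℕ) → Vecℕ k → Set
InPplus k ρ = Decreasing ρ

InA : (k n : ℕ) → Vecℕ k → Set
InA k n ρ = Decreasing ρ × ((i : Fin k) → (0 < ρ i) × (ρ i ≤ n))

-- Extension of ρ ∈ ℤ^k to ρ : ℤ → ℤ with ρ_{j+k} = ρ_j - n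
-- (0-based indices: ρ(r + q k) = ρ_r - q n for 0 ≤ r < k).

ext : (k n : ℕ) .{{_ : NonZero k}} → Vecℕ k → ℤ → ℤ
ext k n ρ j = + ρ (fromℕ< (n%ℕd<d j k)) ℤ.- (j /ℕ k) ℤ.* (+ n)

IsAffinePerm : (k : ℕ) → (ℤ → ℤ) → Set
IsAffinePerm k w =
  (Σ (ℤ → ℤ) λ g → ((m : ℤ) → g (w m) ≡ m) × ((m : ℤ) → w (g m) ≡ m))
  × ((m : ℤ) → w (m ℤ.+ + k) ≡ w m ℤ.+ + k)

-- σ lies in the orbit ν Ŝ_k of the level-n action (ρ∘ŵ)_i = ρ_{ŵ(i)}.
InOrbit : (k n : ℕ) .{{_ : NonZero k}} → Vecℕ k → Vecℕ k → Set
InOrbit k n ν σ =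
  Σ (ℤ → ℤ) λ w → IsAffinePerm k w ×
    ((i : Fin k) → + σ i ≡ ext k n ν (w (+ toℕ i)))

allVecs : (k m : ℕ) → List (Vec (Fin k) m)
allVecs k zero = [] ∷ []
allVecs k (suc m) = concatMap (λ v → map (_∷ v) (allFin k)) (allVecs k m)

allB : {A : Set} → (A → Bool) → List A → Bool
allB p xs = foldr (λ x b → p x ∧ b) true xs

eqFin : {k : ℕ} → Fin k → Fin k → Bool
eqFin i j = ⌊ i ≟ᶠ j ⌋

isInjective : {k : ℕ} → (Fin k → Fin k) → Bool
isInjective {k} f =
  allB (λ i → allB (λ j → not (eqFin (f i) (f j)) ∨ eqFin i j) (allFin k)) (allFin k)

perms : (k : ℕ) → List (Fin k → Fin k)
perms k = L.filterᵇ isInjective (map lookup (allVecs k k))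

count : {A : Set} → (A → Bool) → List A → ℕ
count p xs = length (L.filterᵇ p xs)

-- Coxeter length of w ∈ S_k = number of inversions
len : {k : ℕ} → (Fin k → Fin k) → ℕ
len {k} w = count (λ ij → (toℕ (proj₁ ij) <ᵇ toℕ (proj₂ ij)) ∧ (toℕ (w (proj₂ ij)) <ᵇ toℕ (w (proj₁ ij))))
                  (cartesianProduct (allFin k) (allFin k))

inStab : {k : ℕ} → Vecℕ k → (Fin k → Fin k) → Bool
inStab {k} ρ u = allB (λ i → ρ (u i) ≡ᵇ ρ i) (allFin k)

inMinReps : {k : ℕ} → Vecℕ k → (Fin k → Fin k) → Bool
inMinReps {k} ρ w = allB (λ u → not (inStab ρ u) ∨ (len w ≤ᵇ len (λ i → u (w i)))) (perms k)

-- ∃ α ∈ ℤ^k, μ_{w(i)} + ν_{w'(i)} = λ_i + n α_i  for all i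
-- (all entries natural numbers: equality of residues mod n)
congCond : (k n : ℕ) .{{_ : NonZero n}} → Vecℕ k → Vecℕ k → Vecℕ k →
           (Fin k → Fin k) → (Fin k → Fin k) → Bool
congCond k n lam mu nu w w' =
  allB (λ i → ((mu (w i) + nu (w' i)) % n) ≡ᵇ (lam i % n)) (allFin k)

N : (k n : ℕ) .{{_ : NonZero n}} → (lam mu nu : Vecℕ k) → ℕ
N k n lam mu nu =
  count (λ ww → inMinReps mu (proj₁ ww) ∧ inMinReps nu (proj₂ ww)
                ∧ congCond k n lam mu nu (proj₁ ww) (proj₂ ww))
        (cartesianProduct (perms k) (perms k))

mult : {k : ℕ} → ℕ → Vecℕ k → ℕ
mult {k} j ρ = count (λ i → ρ i ≡ᵇ j) (allFin k)

-- multinomial a [b₁,…,b_r] = C(a,b₁) C(a-b₁,b₂) ⋯ (and 0 unless Σ b = a);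
-- equals a! / (b₁! ⋯ b_r!) when b₁+…+b_r = a.  Trailing zeros are harmless.
multinomial : ℕ → List ℕ → ℕ
multinomial a [] = if a ≡ᵇ 0 then 1 else 0
multinomial a (b ∷ bs) = (a C b) * multinomial (a ∸ b) bs

sumℕ : {k : ℕ} → Vecℕ k → ℕ
sumℕ {k} ρ = foldr (λ i s → ρ i + s) 0 (allFin k)

-- [m_i(ν), m_{i+n}(ν), m_{i+2n}(ν), …]; entries with j > Σν vanish,
-- so listing j = 0 … Σν gives every nonzero term.
multsMod : {k : ℕ} → ℕ → ℕ → Vecℕ k → List ℕ
multsMod n i ν = map (λ j → mult (i + j * n) ν) (upTo (suc (sumℕ ν)))

prodRange : ℕ → (ℕ → ℕ) → ℕ
prodRange n f = product (map (λ i → f (suc i)) (upTo (n ∸ 1)))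

rhs : (k n : ℕ) .{{_ : NonZero n}} → (lam mu nu nuc : Vecℕ k) → ℕ
rhs k n lam mu nu nuc =
  N k n lam mu nuc
  * multinomial (mult n nuc) (multsMod n 0 nu)
  * prodRange n (λ i → multinomial (mult i nuc) (multsMod n i nu))

module Submission where

-- Write |S_ρ| for the order of the stabiliser of ρ in S_k.  The argument has three parts.
--
-- (1) Coset decomposition.  Every right coset S_ρ v contains exactly one minimal-length
--     representative, so summing a function of ρ∘v over all v ∈ S_k equals |S_ρ| times
--     the sum over v ∈ S^ρ.  Applied to the ν-component of N this gives
--        N^λ_{μν} · |S_ν| = #{(w, v) ∈ S^μ × S_k : μ∘w + ν∘v ≡ λ (mod n)}.
-- (2) Invariance.  A point of the orbit ν Ŝ_k has, up to a permutation π ∈ S_k of its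
--     coordinates, the same residues mod n as ν; reindexing v ↦ π∘v shows that the
--     right-hand side above is unchanged when ν is replaced by ν̌.  Hence
--        N^λ_{μν} · |S_ν| = N^λ_{μν̌} · |S_ν̌|.
-- (3) Arithmetic.  |S_ρ| = ∏_a m_a(ρ)!, and since ν̌ ∈ 𝒜_{k,n} has entries in [1,n] with
--     m_c(ν̌) = Σ_j m_{c+jn}(ν) (residues taken in [1,n]), the quotient |S_ν̌| / |S_ν| is
--     exactly the product M of multinomial coefficients.  Cancelling |S_ν| > 0 proves the
--     theorem.

open import Defs
open import Data.Nat
  using (ℕ; NonZero; zero; suc; _+_; _*_; _∸_; _≤_; _<_; z≤n; s≤s; s≤s⁻¹; _≡ᵇ_; _<ᵇ_; _≤ᵇ_; _<?_; _%_; _/_; _!; >-nonZero; >-nonZero⁻¹)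
open import Data.Nat.Properties
open import Data.Nat.DivMod
  using (%-distribˡ-+; m≡m%n+[m/n]*n; [m+kn]%n≡m%n; m<n⇒m%n≡m; n%n≡0; m/n≤m; m/n*n≡m)
open import Data.Nat.Combinatorics using (_C_; k![n∸k]!∣n!)
open import Data.Nat.Combinatorics.Base using (_P′_)
open import Data.Nat.Combinatorics.Specification using (nCk≡n!/k![n-k]!; nP′n≡n!)
open import Data.Nat.ListAction using (product)
open import Data.Nat.Tactic.RingSolver using (solve-∀)
import Data.Integer as Int
open Int using (ℤ)
import Data.Integer.Properties as IntP
open import Data.Integer.Tactic.RingSolver as IntRing using ()
open import Data.Integer.DivMod using (_%ℕ_; _/ℕ_; n%ℕd<d; a≡a%ℕn+[a/ℕn]*n)
open import Data.Bool using (Bool; true; false; _∧_; _∨_; not; T)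
open import Data.Bool.Properties using (T-∧; T-∨)
open import Data.Unit using (tt)
open import Data.Empty using (⊥; ⊥-elim)
open import Data.Sum using (_⊎_; inj₁; inj₂)
open import Data.Product using (Σ; _×_; _,_; proj₁; proj₂)
open import Data.List using (List; []; _∷_; map; concatMap; foldr; _++_; filterᵇ; cartesianProduct; tabulate; allFin; upTo)
open import Data.List.Properties using (map-∘; map-++; upTo-∷ʳ)
open import Data.Nat.ListAction.Properties using (product-++)
open import Data.List.Membership.Propositional using (_∈_)
open import Data.List.Membership.Propositional.Properties using (∈-allFin)
open import Data.List.Relation.Unary.Any using (here; there)
open import Data.Fin using (Fin; zero; suc; toℕ; fromℕ<; punchOut)
open import Data.Fin.Properties
  using (any?; pigeonhole; punchOut-injective; toℕ-injective; toℕ<n; toℕ-fromℕ<)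
  renaming (suc-injective to Fin-suc-injective; _≟_ to _≟ᶠ_; <⇒≢ to <⇒≢ᶠ)
open import Data.Vec using (Vec; []; _∷_; lookup)
open import Data.Fin.Permutation.Components using (transpose; transpose-inverse)
open import Function using (_∘_; id; Equivalence)
open import Relation.Binary.PropositionalEquality
  using (_≡_; refl; sym; trans; cong; cong₂; subst; subst₂; module ≡-Reasoning)
open import Relation.Binary.Definitions using (tri<; tri≈; tri>)
open import Relation.Nullary using (yes; no; ¬_)
open import Relation.Nullary.Decidable using (toWitness; fromWitness; dec-true; dec-false)

𝟙 : Bool → ℕ
𝟙 true = 1
𝟙 false = 0

𝟙-true : ∀ {b} → T b → 𝟙 b ≡ 1
𝟙-true {true} _ = refl

𝟙-false : ∀ {b} → ¬ T b → 𝟙 b ≡ 0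
𝟙-false {true} h = ⊥-elim (h tt)
𝟙-false {false} _ = refl

𝟙-∧ : ∀ a b → 𝟙 (a ∧ b) ≡ 𝟙 a * 𝟙 b
𝟙-∧ true b = sym (+-identityʳ (𝟙 b))
𝟙-∧ false b = refl

𝟙-mono : ∀ {a b} → (T a → T b) → 𝟙 a ≤ 𝟙 b
𝟙-mono {true} h = ≤-reflexive (sym (𝟙-true (h tt)))
𝟙-mono {false} _ = z≤n

𝟙-split : ∀ a b c → (T a → T b ⊎ T c) → (T b → T a) → (T c → T a) → (T b → T c → ⊥) →
  𝟙 a ≡ 𝟙 b + 𝟙 c
𝟙-split true true true _ _ _ disj = ⊥-elim (disj tt tt)
𝟙-split true true false _ _ _ _ = refl
𝟙-split true false true _ _ _ _ = refl
𝟙-split true false false cover _ _ _ with cover tt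
... | inj₁ ()
... | inj₂ ()
𝟙-split false true _ _ b⇒a _ _ = ⊥-elim (b⇒a tt)
𝟙-split false false true _ _ c⇒a _ = ⊥-elim (c⇒a tt)
𝟙-split false false false _ _ _ _ = refl

T-ext : ∀ a b → (T a → T b) → (T b → T a) → a ≡ b
T-ext true true _ _ = refl
T-ext true false to _ = ⊥-elim (to tt)
T-ext false true _ from = ⊥-elim (from tt)
T-ext false false _ _ = refl

not-sound : ∀ {a} → T (not a) → ¬ T a
not-sound {true} ()
not-sound {false} _ ()

not-complete : ∀ {a} → ¬ T a → T (not a)
not-complete {true} h = h tt
not-complete {false} _ = tt

∧-intro : ∀ {a b} → T a → T b → T (a ∧ b)
∧-intro ha hb = Equivalence.from T-∧ (ha , hb)

∧-fst : ∀ {a b} → T (a ∧ b) → T a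
∧-fst h = proj₁ (Equivalence.to T-∧ h)

∧-snd : ∀ {a b} → T (a ∧ b) → T b
∧-snd h = proj₂ (Equivalence.to T-∧ h)

≡ᵇ-sound : ∀ {a b} → T (a ≡ᵇ b) → a ≡ b
≡ᵇ-sound {a} {b} = ≡ᵇ⇒≡ a b

≡ᵇ-complete : ∀ {a b} → a ≡ b → T (a ≡ᵇ b)
≡ᵇ-complete {a} {b} = ≡⇒≡ᵇ a b

eqFin-sound : ∀ {k} {i j : Fin k} → T (eqFin i j) → i ≡ j
eqFin-sound = toWitness

eqFin-complete : ∀ {k} {i j : Fin k} → i ≡ j → T (eqFin i j)
eqFin-complete = fromWitness

∑ : {A : Set} → (A → ℕ) → List A → ℕ
∑ f [] = 0
∑ f (x ∷ xs) = f x + ∑ f xs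

count-as-∑ : {A : Set} (p : A → Bool) (xs : List A) → count p xs ≡ ∑ (𝟙 ∘ p) xs
count-as-∑ p [] = refl
count-as-∑ p (x ∷ xs) with p x
... | true = cong suc (count-as-∑ p xs)
... | false = count-as-∑ p xs

∑-cong : {A : Set} {f g : A → ℕ} (xs : List A) → (∀ x → x ∈ xs → f x ≡ g x) → ∑ f xs ≡ ∑ g xs
∑-cong [] _ = refl
∑-cong (x ∷ xs) h = cong₂ _+_ (h x (here refl)) (∑-cong xs (λ y y∈ → h y (there y∈)))

∑-cong′ : {A : Set} {f g : A → ℕ} (xs : List A) → (∀ x → f x ≡ g x) → ∑ f xs ≡ ∑ g xs
∑-cong′ xs h = ∑-cong xs (λ x _ → h x)

∑-zero : {A : Set} (xs : List A) → ∑ (λ _ → 0) xs ≡ 0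
∑-zero [] = refl
∑-zero (_ ∷ xs) = ∑-zero xs

∑-++ : {A : Set} (f : A → ℕ) (xs ys : List A) → ∑ f (xs ++ ys) ≡ ∑ f xs + ∑ f ys
∑-++ f [] ys = refl
∑-++ f (x ∷ xs) ys = trans (cong (f x +_) (∑-++ f xs ys)) (sym (+-assoc (f x) _ _))

∑-map : {A B : Set} (f : B → ℕ) (g : A → B) (xs : List A) → ∑ f (map g xs) ≡ ∑ (f ∘ g) xs
∑-map f g [] = refl
∑-map f g (x ∷ xs) = cong (f (g x) +_) (∑-map f g xs)

∑-concatMap : {A B : Set} (f : B → ℕ) (g : A → List B) (xs : List A) →
  ∑ f (concatMap g xs) ≡ ∑ (λ x → ∑ f (g x)) xs
∑-concatMap f g [] = refl
∑-concatMap f g (x ∷ xs) = trans (∑-++ f (g x) _) (cong (∑ f (g x) +_) (∑-concatMap f g xs))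

∑-cartesian : {A B : Set} (f : A × B → ℕ) (xs : List A) (ys : List B) →
  ∑ f (cartesianProduct xs ys) ≡ ∑ (λ x → ∑ (λ y → f (x , y)) ys) xs
∑-cartesian f [] ys = refl
∑-cartesian f (x ∷ xs) ys =
  trans (∑-++ f (map (x ,_) ys) _) (cong₂ _+_ (∑-map f (x ,_) ys) (∑-cartesian f xs ys))

∑-+ : {A : Set} (f g : A → ℕ) (xs : List A) → ∑ (λ x → f x + g x) xs ≡ ∑ f xs + ∑ g xs
∑-+ f g [] = refl
∑-+ f g (x ∷ xs) = trans (cong (f x + g x +_) (∑-+ f g xs)) (+-exch (f x) (g x) _ _)
  where
  +-exch : ∀ a b c d → a + b + (c + d) ≡ a + c + (b + d)
  +-exch = solve-∀

∑-*ˡ : {A : Set} (c : ℕ) (f : A → ℕ) (xs : List A) → ∑ (λ x → c * f x) xs ≡ c * ∑ f xs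
∑-*ˡ c f [] = sym (*-zeroʳ c)
∑-*ˡ c f (x ∷ xs) = trans (cong (c * f x +_) (∑-*ˡ c f xs)) (sym (*-distribˡ-+ c (f x) _))

∑-*ʳ : {A : Set} (c : ℕ) (f : A → ℕ) (xs : List A) → ∑ (λ x → f x * c) xs ≡ ∑ f xs * c
∑-*ʳ c f xs = trans (∑-cong′ xs (λ x → *-comm (f x) c)) (trans (∑-*ˡ c f xs) (*-comm c _))

∑-swap : {A B : Set} (f : A → B → ℕ) (xs : List A) (ys : List B) →
  ∑ (λ x → ∑ (f x) ys) xs ≡ ∑ (λ y → ∑ (λ x → f x y) xs) ys
∑-swap f [] ys = sym (∑-zero ys)
∑-swap f (x ∷ xs) ys =
  trans (cong (∑ (f x) ys +_) (∑-swap f xs ys)) (sym (∑-+ (f x) (λ y → ∑ (λ x' → f x' y) xs) ys))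

∑-mono : {A : Set} {f g : A → ℕ} (xs : List A) → (∀ x → x ∈ xs → f x ≤ g x) → ∑ f xs ≤ ∑ g xs
∑-mono [] _ = z≤n
∑-mono (x ∷ xs) h = +-mono-≤ (h x (here refl)) (∑-mono xs (λ y y∈ → h y (there y∈)))

∑-mono-< : {A : Set} {f g : A → ℕ} (xs : List A) → (∀ x → x ∈ xs → f x ≤ g x) →
  ∀ x₀ → x₀ ∈ xs → f x₀ < g x₀ → ∑ f xs < ∑ g xs
∑-mono-< (x ∷ xs) h x₀ (here refl) lt = +-mono-<-≤ lt (∑-mono xs (λ y y∈ → h y (there y∈)))
∑-mono-< (x ∷ xs) h x₀ (there x₀∈) lt =
  +-mono-≤-< (h x (here refl)) (∑-mono-< xs (λ y y∈ → h y (there y∈)) x₀ x₀∈ lt)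

∑-term≤ : {A : Set} (f : A → ℕ) (xs : List A) (x : A) → x ∈ xs → f x ≤ ∑ f xs
∑-term≤ f (y ∷ xs) x (here refl) = m≤m+n (f x) _
∑-term≤ f (y ∷ xs) x (there x∈) = ≤-trans (∑-term≤ f xs x x∈) (m≤n+m _ (f y))

∑-filter : {A : Set} (f : A → ℕ) (q : A → Bool) (xs : List A) →
  ∑ f (filterᵇ q xs) ≡ ∑ (λ x → 𝟙 (q x) * f x) xs
∑-filter f q [] = refl
∑-filter f q (x ∷ xs) with q x
... | true = cong₂ _+_ (sym (+-identityʳ (f x))) (∑-filter f q xs)
... | false = ∑-filter f q xs

∈-filterᵇ : {A : Set} (q : A → Bool) (xs : List A) {x : A} → x ∈ filterᵇ q xs → T (q x)
∈-filterᵇ q (y ∷ xs) x∈ with q y in eq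
∈-filterᵇ q (y ∷ xs) (here refl) | true = subst T (sym eq) tt
∈-filterᵇ q (y ∷ xs) (there x∈) | true = ∈-filterᵇ q xs x∈
∈-filterᵇ q (y ∷ xs) x∈ | false = ∈-filterᵇ q xs x∈

∑𝟙-witness : {A : Set} (p : A → Bool) (xs : List A) → 0 < ∑ (𝟙 ∘ p) xs → Σ A λ x → x ∈ xs × T (p x)
∑𝟙-witness p (x ∷ xs) pos with p x in eq
... | true = x , here refl , subst T (sym eq) tt
... | false with ∑𝟙-witness p xs pos
... | y , y∈ , py = y , there y∈ , py

double-count : {A B : Set} (f : A → ℕ) (R : A → B → ℕ) (xs : List A) (ys : List B) →
  (∀ x → x ∈ xs → ∑ (R x) ys ≡ 1) →
  ∑ f xs ≡ ∑ (λ y → ∑ (λ x → R x y * f x) xs) ys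
double-count f R xs ys total =
  trans (∑-cong xs spread) (∑-swap (λ x y → R x y * f x) xs ys)
  where
  spread : ∀ x → x ∈ xs → f x ≡ ∑ (λ y → R x y * f x) ys
  spread x x∈ = begin
    f x                    ≡⟨ sym (*-identityˡ (f x)) ⟩
    1 * f x                ≡⟨ cong (_* f x) (sym (total x x∈)) ⟩
    ∑ (R x) ys * f x       ≡⟨ sym (∑-*ʳ (f x) (R x) ys) ⟩
    ∑ (λ y → R x y * f x) ys ∎
    where open ≡-Reasoning

∑-tabulate : {A : Set} {k : ℕ} (f : A → ℕ) (g : Fin k → A) → ∑ f (tabulate g) ≡ ∑ (f ∘ g) (allFin k)
∑-tabulate {k = zero} f g = refl
∑-tabulate {k = suc k} f g =
  cong (f (g zero) +_) (trans (∑-tabulate f (g ∘ suc)) (sym (∑-tabulate (f ∘ g) suc)))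

∑-allFin-suc : {k : ℕ} (f : Fin (suc k) → ℕ) → ∑ f (allFin (suc k)) ≡ f zero + ∑ (f ∘ suc) (allFin k)
∑-allFin-suc f = cong (f zero +_) (∑-tabulate f suc)

allB-sound : {A : Set} (p : A → Bool) (xs : List A) → T (allB p xs) → ∀ x → x ∈ xs → T (p x)
allB-sound p (y ∷ xs) h x x∈ with p y in eq
allB-sound p (y ∷ xs) h x (here refl) | true = subst T (sym eq) tt
allB-sound p (y ∷ xs) h x (there x∈) | true = allB-sound p xs h x x∈

allB-complete : {A : Set} (p : A → Bool) (xs : List A) → (∀ x → x ∈ xs → T (p x)) → T (allB p xs)
allB-complete p [] _ = tt
allB-complete p (y ∷ xs) h with p y in eq
... | true = allB-complete p xs (λ x x∈ → h x (there x∈))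
... | false = subst T eq (h y (here refl))

allB-cong : {A : Set} (p q : A → Bool) (xs : List A) → (∀ x → p x ≡ q x) → allB p xs ≡ allB q xs
allB-cong p q [] _ = refl
allB-cong p q (x ∷ xs) e = cong₂ _∧_ (e x) (allB-cong p q xs e)

∀Fin-sound : {k : ℕ} (p : Fin k → Bool) → T (allB p (allFin k)) → ∀ i → T (p i)
∀Fin-sound p h i = allB-sound p _ h i (∈-allFin i)

∀Fin-complete : {k : ℕ} (p : Fin k → Bool) → (∀ i → T (p i)) → T (allB p (allFin k))
∀Fin-complete {k} p h = allB-complete p (allFin k) (λ x _ → h x)

allB-tabulate : {A : Set} {m : ℕ} (p : A → Bool) (g : Fin m → A) →
  allB p (tabulate g) ≡ allB (p ∘ g) (allFin m)
allB-tabulate {m = zero} p g = refl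
allB-tabulate {m = suc m} p g =
  cong (p (g zero) ∧_) (trans (allB-tabulate p (g ∘ suc)) (sym (allB-tabulate (p ∘ g) suc)))

allB-allFin-suc : {k : ℕ} (p : Fin (suc k) → Bool) → allB p (allFin (suc k)) ≡ p zero ∧ allB (p ∘ suc) (allFin k)
allB-allFin-suc p = cong (p zero ∧_) (allB-tabulate p suc)

∑-point : {k : ℕ} (a : Fin k) (f : Fin k → ℕ) → ∑ (λ x → 𝟙 (eqFin x a) * f x) (allFin k) ≡ f a
∑-point {suc k} zero f =
  trans (∑-allFin-suc (λ x → 𝟙 (eqFin x zero) * f x))
        (trans (cong₂ _+_ (*-identityˡ (f zero)) (∑-zero (allFin k))) (+-identityʳ _))
∑-point {suc k} (suc a) f =
  trans (∑-allFin-suc (λ x → 𝟙 (eqFin x (suc a)) * f x))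
        (trans (∑-cong′ (allFin k) (λ x → cong (λ b → 𝟙 b * f (suc x)) (eqFin-suc x)))
               (∑-point a (f ∘ suc)))
  where
  eqFin-suc : ∀ x → eqFin (suc x) (suc a) ≡ eqFin x a
  eqFin-suc x = T-ext _ _ (λ h → eqFin-complete (Fin-suc-injective (eqFin-sound h)))
                          (λ h → eqFin-complete (cong suc (eqFin-sound h)))

∑-point1 : {k : ℕ} (a : Fin k) → ∑ (λ x → 𝟙 (eqFin x a)) (allFin k) ≡ 1
∑-point1 {k} a = trans (∑-cong′ (allFin k) (λ x → sym (*-identityʳ (𝟙 (eqFin x a))))) (∑-point a (λ _ → 1))

∑-initial : (k m : ℕ) → m ≤ k → ∑ (λ x → 𝟙 (toℕ x <ᵇ m)) (allFin k) ≡ m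
∑-initial zero zero _ = refl
∑-initial (suc k) zero _ = trans (∑-allFin-suc {k} (λ x → 𝟙 (toℕ x <ᵇ 0))) (∑-zero (allFin k))
∑-initial (suc k) (suc m) (s≤s m≤k) = trans (∑-allFin-suc {k} (λ x → 𝟙 (toℕ x <ᵇ suc m))) (cong suc (∑-initial k m m≤k))

Inj : {m k : ℕ} → (Fin m → Fin k) → Set
Inj f = ∀ i j → f i ≡ f j → i ≡ j

Inj-∘ : {k : ℕ} (f g : Fin k → Fin k) → Inj f → Inj g → Inj (f ∘ g)
Inj-∘ f g f-inj g-inj i j e = g-inj i j (f-inj (g i) (g j) e)

-- The Boolean injectivity test of `Defs`, for maps between possibly different Fin's
-- (`isInjective` is its instance with m = k).
injectiveᵇ : {m k : ℕ} → (Fin m → Fin k) → Bool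
injectiveᵇ {m} f = allB (λ i → allB (λ j → not (eqFin (f i) (f j)) ∨ eqFin i j) (allFin m)) (allFin m)

→-sound : ∀ {a b} → T (not a ∨ b) → T a → T b
→-sound {true} h _ = h

→-complete : ∀ {a b} → (T a → T b) → T (not a ∨ b)
→-complete {true} h = h tt
→-complete {false} _ = tt

injectiveᵇ-sound : {m k : ℕ} (f : Fin m → Fin k) → T (injectiveᵇ f) → Inj f
injectiveᵇ-sound f h i j e = eqFin-sound (→-sound (∀Fin-sound _ (∀Fin-sound _ h i) j) (eqFin-complete e))

injectiveᵇ-complete : {m k : ℕ} (f : Fin m → Fin k) → Inj f → T (injectiveᵇ f)
injectiveᵇ-complete f f-inj =
  ∀Fin-complete _ (λ i → ∀Fin-complete _ (λ j → →-complete (λ t → eqFin-complete (f-inj i j (eqFin-sound t)))))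

Inj-surjective : {k : ℕ} (f : Fin k → Fin k) → Inj f → ∀ a → Σ (Fin k) λ i → f i ≡ a
Inj-surjective {k} f f-inj a with any? (λ i → f i ≟ᶠ a)
... | yes hit = hit
... | no miss = ⊥-elim (impossible k f f-inj a miss)
  where
  impossible : ∀ k (f : Fin k → Fin k) → Inj f → (a : Fin k) → ¬ (Σ (Fin k) λ i → f i ≡ a) → ⊥
  impossible (suc k) f f-inj a miss
    with pigeonhole (n<1+n k) (λ i → punchOut {i = a} {j = f i} (λ e → miss (i , sym e)))
  ... | i , j , i<j , e =
    <⇒≢ᶠ i<j (f-inj i j (punchOut-injective (λ e → miss (i , sym e)) (λ e → miss (j , sym e)) e))

∑-reindex : {k : ℕ} (π : Fin k → Fin k) → Inj π → (f : Fin k → ℕ) →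
  ∑ (f ∘ π) (allFin k) ≡ ∑ f (allFin k)
∑-reindex {k} π π-inj f =
  trans (double-count (f ∘ π) (λ x y → 𝟙 (eqFin y (π x))) (allFin k) (allFin k) (λ x _ → ∑-point1 (π x)))
        (∑-cong′ (allFin k) collect)
  where
  preimage-unique : ∀ y → ∑ (λ x → 𝟙 (eqFin y (π x))) (allFin k) ≡ 1
  preimage-unique y with Inj-surjective π π-inj y
  ... | x₀ , πx₀≡y =
    trans (∑-cong′ (allFin k) (λ x → cong 𝟙 (T-ext _ _
            (λ h → eqFin-complete (π-inj x x₀ (trans (sym (eqFin-sound h)) (sym πx₀≡y))))
            (λ h → eqFin-complete (trans (sym πx₀≡y) (cong π (sym (eqFin-sound h))))))))
          (∑-point1 x₀)
  at-preimage : ∀ y x → 𝟙 (eqFin y (π x)) * f (π x) ≡ 𝟙 (eqFin y (π x)) * f y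
  at-preimage y x with eqFin y (π x) in eq
  ... | true = cong (λ z → 1 * f z) (sym (eqFin-sound (subst T (sym eq) tt)))
  ... | false = refl
  collect : ∀ y → ∑ (λ x → 𝟙 (eqFin y (π x)) * f (π x)) (allFin k) ≡ f y
  collect y = begin
    ∑ (λ x → 𝟙 (eqFin y (π x)) * f (π x)) (allFin k) ≡⟨ ∑-cong′ (allFin k) (at-preimage y) ⟩
    ∑ (λ x → 𝟙 (eqFin y (π x)) * f y) (allFin k)     ≡⟨ ∑-*ʳ (f y) _ (allFin k) ⟩
    ∑ (λ x → 𝟙 (eqFin y (π x))) (allFin k) * f y     ≡⟨ cong (_* f y) (preimage-unique y) ⟩
    1 * f y                                          ≡⟨ *-identityˡ (f y) ⟩
    f y ∎
    where open ≡-Reasoning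

_≗ᵇ_ : {m k : ℕ} (f g : Fin m → Fin k) → Bool
_≗ᵇ_ {m} f g = allB (λ i → eqFin (f i) (g i)) (allFin m)

≗ᵇ-sound : {m k : ℕ} {f g : Fin m → Fin k} → T (f ≗ᵇ g) → ∀ i → f i ≡ g i
≗ᵇ-sound {f = f} {g} h i = eqFin-sound (∀Fin-sound (λ i → eqFin (f i) (g i)) h i)

≗ᵇ-complete : {m k : ℕ} {f g : Fin m → Fin k} → (∀ i → f i ≡ g i) → T (f ≗ᵇ g)
≗ᵇ-complete {f = f} {g} h = ∀Fin-complete (λ i → eqFin (f i) (g i)) (λ i → eqFin-complete (h i))

allVecs-unique : {k : ℕ} (m : ℕ) (g : Fin m → Fin k) → ∑ (λ v → 𝟙 (lookup v ≗ᵇ g)) (allVecs k m) ≡ 1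
allVecs-unique zero g = refl
allVecs-unique {k} (suc m) g =
  trans (∑-concatMap (λ v → 𝟙 (lookup v ≗ᵇ g)) (λ v → map (_∷ v) (allFin k)) (allVecs k m))
        (trans (∑-cong′ (allVecs k m) choose-head) (allVecs-unique m (g ∘ suc)))
  where
  choose-head : ∀ v → ∑ (λ u → 𝟙 (lookup u ≗ᵇ g)) (map (_∷ v) (allFin k)) ≡ 𝟙 (lookup v ≗ᵇ (g ∘ suc))
  choose-head v = begin
    ∑ (λ u → 𝟙 (lookup u ≗ᵇ g)) (map (_∷ v) (allFin k))
      ≡⟨ ∑-map (λ u → 𝟙 (lookup u ≗ᵇ g)) (_∷ v) (allFin k) ⟩
    ∑ (λ x → 𝟙 (lookup (x ∷ v) ≗ᵇ g)) (allFin k)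
      ≡⟨ ∑-cong′ (allFin k) split-head ⟩
    ∑ (λ x → tail * 𝟙 (eqFin x (g zero))) (allFin k)
      ≡⟨ ∑-*ˡ tail (λ x → 𝟙 (eqFin x (g zero))) (allFin k) ⟩
    tail * ∑ (λ x → 𝟙 (eqFin x (g zero))) (allFin k)
      ≡⟨ cong (tail *_) (∑-point1 (g zero)) ⟩
    tail * 1
      ≡⟨ *-identityʳ tail ⟩
    tail ∎
    where
    open ≡-Reasoning
    tail : ℕ
    tail = 𝟙 (lookup v ≗ᵇ (g ∘ suc))
    split-head : ∀ x → 𝟙 (lookup (x ∷ v) ≗ᵇ g) ≡ tail * 𝟙 (eqFin x (g zero))
    split-head x = trans (cong 𝟙 (allB-allFin-suc (λ i → eqFin (lookup (x ∷ v) i) (g i))))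
                         (trans (𝟙-∧ (eqFin x (g zero)) _) (*-comm (𝟙 (eqFin x (g zero))) tail))

perms-unique : {k : ℕ} (f : Fin k → Fin k) → Inj f → ∑ (λ v → 𝟙 (v ≗ᵇ f)) (perms k) ≡ 1
perms-unique {k} f f-inj = begin
  ∑ (λ v → 𝟙 (v ≗ᵇ f)) (perms k)
    ≡⟨ ∑-filter (λ v → 𝟙 (v ≗ᵇ f)) isInjective (map lookup (allVecs k k)) ⟩
  ∑ (λ v → 𝟙 (isInjective v) * 𝟙 (v ≗ᵇ f)) (map lookup (allVecs k k))
    ≡⟨ ∑-map (λ v → 𝟙 (isInjective v) * 𝟙 (v ≗ᵇ f)) lookup (allVecs k k) ⟩
  ∑ (λ v → 𝟙 (isInjective (lookup v)) * 𝟙 (lookup v ≗ᵇ f)) (allVecs k k)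
    ≡⟨ ∑-cong′ (allVecs k k) (λ v → drop-test (lookup v)) ⟩
  ∑ (λ v → 𝟙 (lookup v ≗ᵇ f)) (allVecs k k)
    ≡⟨ allVecs-unique k f ⟩
  1 ∎
  where
  open ≡-Reasoning
  -- a map that agrees with the injection f passes the injectivity test
  drop-test : ∀ v → 𝟙 (isInjective v) * 𝟙 (v ≗ᵇ f) ≡ 𝟙 (v ≗ᵇ f)
  drop-test v with v ≗ᵇ f in eq
  ... | false = *-zeroʳ (𝟙 (isInjective v))
  ... | true = cong (_* 1) (𝟙-true (injectiveᵇ-complete v v-inj))
    where
    v≗f : ∀ i → v i ≡ f i
    v≗f = ≗ᵇ-sound (subst T (sym eq) tt)
    v-inj : Inj v
    v-inj i j e = f-inj i j (trans (sym (v≗f i)) (trans e (v≗f j)))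

perms-inj : {k : ℕ} {w : Fin k → Fin k} → w ∈ perms k → Inj w
perms-inj {k} {w} w∈ = injectiveᵇ-sound w (∈-filterᵇ isInjective (map lookup (allVecs k k)) w∈)

perms-complete : {k : ℕ} (f : Fin k → Fin k) → Inj f → Σ (Fin k → Fin k) λ w → w ∈ perms k × (∀ i → w i ≡ f i)
perms-complete {k} f f-inj with ∑𝟙-witness (_≗ᵇ f) (perms k) (subst (0 <_) (sym (perms-unique f f-inj)) (s≤s z≤n))
... | w , w∈ , w≗f = w , w∈ , ≗ᵇ-sound w≗f

Extensional : {A B : Set} → ((A → B) → ℕ) → Set
Extensional g = ∀ f f' → (∀ x → f x ≡ f' x) → g f ≡ g f'

∑perms-translate : {k : ℕ} (π : Fin k → Fin k) → Inj π → (g : (Fin k → Fin k) → ℕ) → Extensional g →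
  ∑ (λ v → g (π ∘ v)) (perms k) ≡ ∑ g (perms k)
∑perms-translate {k} π π-inj g g-ext =
  trans (double-count (λ v → g (π ∘ v)) (λ v w → 𝟙 (w ≗ᵇ (π ∘ v))) (perms k) (perms k)
                      (λ v v∈ → perms-unique (π ∘ v) (Inj-∘ π v π-inj (perms-inj v∈))))
        (∑-cong (perms k) (λ w w∈ → collect w (perms-inj w∈)))
  where
  π⁻¹ : Fin k → Fin k
  π⁻¹ y = proj₁ (Inj-surjective π π-inj y)
  ππ⁻¹ : ∀ y → π (π⁻¹ y) ≡ y
  ππ⁻¹ y = proj₂ (Inj-surjective π π-inj y)
  solve-for-v : ∀ w v → (w ≗ᵇ (π ∘ v)) ≡ (v ≗ᵇ (π⁻¹ ∘ w))
  solve-for-v w v = T-ext _ _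
    (λ h → ≗ᵇ-complete (λ i → π-inj (v i) (π⁻¹ (w i)) (trans (sym (≗ᵇ-sound h i)) (sym (ππ⁻¹ (w i))))))
    (λ h → ≗ᵇ-complete (λ i → trans (sym (ππ⁻¹ (w i))) (cong π (sym (≗ᵇ-sound h i)))))
  π⁻¹∘w-inj : ∀ w → Inj w → Inj (π⁻¹ ∘ w)
  π⁻¹∘w-inj w w-inj i j e = w-inj i j (trans (sym (ππ⁻¹ (w i))) (trans (cong π e) (ππ⁻¹ (w j))))
  at-solution : ∀ w v → 𝟙 (w ≗ᵇ (π ∘ v)) * g (π ∘ v) ≡ 𝟙 (w ≗ᵇ (π ∘ v)) * g w
  at-solution w v with w ≗ᵇ (π ∘ v) in eq
  ... | true = cong (1 *_) (g-ext (π ∘ v) w (λ i → sym (≗ᵇ-sound (subst T (sym eq) tt) i)))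
  ... | false = refl
  collect : ∀ w → Inj w → ∑ (λ v → 𝟙 (w ≗ᵇ (π ∘ v)) * g (π ∘ v)) (perms k) ≡ g w
  collect w w-inj = begin
    ∑ (λ v → 𝟙 (w ≗ᵇ (π ∘ v)) * g (π ∘ v)) (perms k) ≡⟨ ∑-cong′ (perms k) (at-solution w) ⟩
    ∑ (λ v → 𝟙 (w ≗ᵇ (π ∘ v)) * g w) (perms k)       ≡⟨ ∑-*ʳ (g w) _ (perms k) ⟩
    ∑ (λ v → 𝟙 (w ≗ᵇ (π ∘ v))) (perms k) * g w       ≡⟨ cong (λ z → z * g w) solutions ⟩
    1 * g w                                          ≡⟨ *-identityˡ (g w) ⟩
    g w ∎
    where
    open ≡-Reasoning
    solutions : ∑ (λ v → 𝟙 (w ≗ᵇ (π ∘ v))) (perms k) ≡ 1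
    solutions = trans (∑-cong′ (perms k) (λ v → cong 𝟙 (solve-for-v w v)))
                      (perms-unique (π⁻¹ ∘ w) (π⁻¹∘w-inj w w-inj))

∏< : (ℕ → ℕ) → ℕ → ℕ
∏< f zero = 1
∏< f (suc B) = ∏< f B * f B

∏<-cong : (f g : ℕ → ℕ) (B : ℕ) → (∀ a → a < B → f a ≡ g a) → ∏< f B ≡ ∏< g B
∏<-cong f g zero _ = refl
∏<-cong f g (suc B) h = cong₂ _*_ (∏<-cong f g B (λ a a<B → h a (m<n⇒m<1+n a<B))) (h B (n<1+n B))

∏<-const1 : (B : ℕ) → ∏< (λ _ → 1) B ≡ 1
∏<-const1 zero = refl
∏<-const1 (suc B) = cong (_* 1) (∏<-const1 B)

∏<-positive : (f : ℕ → ℕ) (B : ℕ) → (∀ a → 0 < f a) → 0 < ∏< f B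
∏<-positive f zero _ = s≤s z≤n
∏<-positive f (suc B) pos = *-mono-< (∏<-positive f B pos) (pos B)

∏<-scale-one : (f f' : ℕ → ℕ) (x c₀ B : ℕ) → c₀ < B → f' c₀ ≡ x * f c₀ → (∀ a → ¬ a ≡ c₀ → f' a ≡ f a) →
  ∏< f' B ≡ x * ∏< f B
∏<-scale-one f f' x c₀ (suc B) c₀<1+B scaled same with B ≟ c₀
... | yes refl = trans (cong₂ _*_ (∏<-cong f' f B (λ a a<B → same a (<⇒≢ a<B))) scaled) (rearrange (∏< f B) x (f B))
  where
  rearrange : ∀ a b c → a * (b * c) ≡ b * (a * c)
  rearrange = solve-∀
... | no B≢c₀ = trans (cong₂ _*_ (∏<-scale-one f f' x c₀ B (≤∧≢⇒< (s≤s⁻¹ c₀<1+B) (λ e → B≢c₀ (sym e))) scaled same)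
                                 (same B B≢c₀))
                      (*-assoc x (∏< f B) (f B))

occ : {k : ℕ} → (Fin k → ℕ) → ℕ → ℕ
occ {k} κ a = ∑ (λ x → 𝟙 (κ x ≡ᵇ a)) (allFin k)

mult≡occ : {k : ℕ} (a : ℕ) (κ : Fin k → ℕ) → mult a κ ≡ occ κ a
mult≡occ {k} a κ = count-as-∑ (λ i → κ i ≡ᵇ a) (allFin k)

occ-cong : {m : ℕ} (g h : Fin m → ℕ) → (∀ i → g i ≡ h i) → ∀ a → occ g a ≡ occ h a
occ-cong {m} g h g≗h a = ∑-cong′ (allFin m) (λ i → cong (λ z → 𝟙 (z ≡ᵇ a)) (g≗h i))

occ-reindex : {k : ℕ} (κ : Fin k → ℕ) (π : Fin k → Fin k) → Inj π → ∀ a → occ (κ ∘ π) a ≡ occ κ a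
occ-reindex κ π π-inj a = ∑-reindex π π-inj (λ x → 𝟙 (κ x ≡ᵇ a))

occ-suc : {m : ℕ} (c : Fin (suc m) → ℕ) (a : ℕ) → occ c a ≡ 𝟙 (c zero ≡ᵇ a) + occ (c ∘ suc) a
occ-suc c a = ∑-allFin-suc (λ j → 𝟙 (c j ≡ᵇ a))

hasValues : {m k : ℕ} → (Fin k → ℕ) → (Fin m → Fin k) → (Fin m → ℕ) → Bool
hasValues {m} κ f c = allB (λ i → κ (f i) ≡ᵇ c i) (allFin m)

hasValues-sound : {m k : ℕ} (κ : Fin k → ℕ) (f : Fin m → Fin k) (c : Fin m → ℕ) →
  T (hasValues κ f c) → ∀ i → κ (f i) ≡ c i
hasValues-sound κ f c h i = ≡ᵇ-sound (∀Fin-sound _ h i)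

hasValues-complete : {m k : ℕ} (κ : Fin k → ℕ) (f : Fin m → Fin k) (c : Fin m → ℕ) →
  (∀ i → κ (f i) ≡ c i) → T (hasValues κ f c)
hasValues-complete κ f c h = ∀Fin-complete _ (λ i → ≡ᵇ-complete (h i))

notInImage : {m k : ℕ} → Fin k → (Fin m → Fin k) → Bool
notInImage {m} x f = allB (λ j → not (eqFin x (f j))) (allFin m)

injectiveᵇ-cons : {m k : ℕ} (x : Fin k) (v : Vec (Fin k) m) →
  injectiveᵇ (lookup (x ∷ v)) ≡ notInImage x (lookup v) ∧ injectiveᵇ (lookup v)
injectiveᵇ-cons x v = T-ext _ _ forward backward
  where
  forward : T (injectiveᵇ (lookup (x ∷ v))) → T (notInImage x (lookup v) ∧ injectiveᵇ (lookup v))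
  forward h = ∧-intro (∀Fin-complete _ (λ j → fresh j))
                      (injectiveᵇ-complete (lookup v) (λ i j e → Fin-suc-injective (inj (suc i) (suc j) e)))
    where
    inj = injectiveᵇ-sound (lookup (x ∷ v)) h
    fresh : ∀ j → T (not (eqFin x (lookup v j)))
    fresh j = not-complete (λ t → zero≢suc (inj zero (suc j) (eqFin-sound t)))
      where
      zero≢suc : ∀ {n} {j : Fin n} → ¬ zero ≡ suc j
      zero≢suc ()
  backward : T (notInImage x (lookup v) ∧ injectiveᵇ (lookup v)) → T (injectiveᵇ (lookup (x ∷ v)))
  backward h = injectiveᵇ-complete (lookup (x ∷ v)) inj
    where
    x∉v : ∀ j → ¬ x ≡ lookup v j
    x∉v j e = not-sound (∀Fin-sound _ (∧-fst h) j) (eqFin-complete e)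
    inj : Inj (lookup (x ∷ v))
    inj zero zero _ = refl
    inj zero (suc j) e = ⊥-elim (x∉v j e)
    inj (suc i) zero e = ⊥-elim (x∉v i (sym e))
    inj (suc i) (suc j) e = cong suc (injectiveᵇ-sound (lookup v) (∧-snd h) i j e)

image-dichotomy : {m k : ℕ} (x : Fin k) (f : Fin m → Fin k) → Inj f →
  𝟙 (notInImage x f) + ∑ (λ j → 𝟙 (eqFin x (f j))) (allFin m) ≡ 1
image-dichotomy {m} x f f-inj with any? (λ j → f j ≟ᶠ x)
... | yes (j₀ , fj₀≡x) =
  trans (cong₂ _+_ (𝟙-false (λ t → not-sound (∀Fin-sound _ t j₀) (eqFin-complete (sym fj₀≡x))))
                   (∑-cong′ (allFin m) (λ j → cong 𝟙 (T-ext (eqFin x (f j)) (eqFin j j₀)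
                      (λ t → eqFin-complete (f-inj j j₀ (trans (sym (eqFin-sound t)) (sym fj₀≡x))))
                      (λ t → eqFin-complete (trans (sym fj₀≡x) (cong f (sym (eqFin-sound t)))))))))
        (∑-point1 j₀)
... | no x∉ =
  trans (cong₂ _+_ (𝟙-true (∀Fin-complete _ (λ j → not-complete (λ t → x∉ (j , sym (eqFin-sound t))))))
                   (∑-cong′ (allFin m) (λ j → 𝟙-false (λ t → x∉ (j , sym (eqFin-sound t))))))
        (cong suc (∑-zero (allFin m)))

fresh-values : {m k : ℕ} (κ : Fin k → ℕ) (f : Fin m → Fin k) → Inj f → (a : ℕ) →
  ∑ (λ x → 𝟙 (notInImage x f) * 𝟙 (κ x ≡ᵇ a)) (allFin k) ≡ occ κ a ∸ occ (κ ∘ f) a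
fresh-values {m} {k} κ f f-inj a = sym (trans (cong (_∸ occ (κ ∘ f) a) split) (m+n∸n≡m fresh (occ (κ ∘ f) a)))
  where
  fresh : ℕ
  fresh = ∑ (λ x → 𝟙 (notInImage x f) * 𝟙 (κ x ≡ᵇ a)) (allFin k)
  split-term : ∀ x → 𝟙 (κ x ≡ᵇ a) ≡ 𝟙 (notInImage x f) * 𝟙 (κ x ≡ᵇ a)
                                    + ∑ (λ j → 𝟙 (eqFin x (f j))) (allFin m) * 𝟙 (κ x ≡ᵇ a)
  split-term x = trans (sym (*-identityˡ _))
                   (trans (cong (_* 𝟙 (κ x ≡ᵇ a)) (sym (image-dichotomy x f f-inj)))
                          (*-distribʳ-+ (𝟙 (κ x ≡ᵇ a)) (𝟙 (notInImage x f)) _))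
  in-image : ∑ (λ x → ∑ (λ j → 𝟙 (eqFin x (f j))) (allFin m) * 𝟙 (κ x ≡ᵇ a)) (allFin k) ≡ occ (κ ∘ f) a
  in-image = begin
    ∑ (λ x → ∑ (λ j → 𝟙 (eqFin x (f j))) (allFin m) * 𝟙 (κ x ≡ᵇ a)) (allFin k)
      ≡⟨ ∑-cong′ (allFin k) (λ x → sym (∑-*ʳ (𝟙 (κ x ≡ᵇ a)) (λ j → 𝟙 (eqFin x (f j))) (allFin m))) ⟩
    ∑ (λ x → ∑ (λ j → 𝟙 (eqFin x (f j)) * 𝟙 (κ x ≡ᵇ a)) (allFin m)) (allFin k)
      ≡⟨ ∑-swap (λ x j → 𝟙 (eqFin x (f j)) * 𝟙 (κ x ≡ᵇ a)) (allFin k) (allFin m) ⟩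
    ∑ (λ j → ∑ (λ x → 𝟙 (eqFin x (f j)) * 𝟙 (κ x ≡ᵇ a)) (allFin k)) (allFin m)
      ≡⟨ ∑-cong′ (allFin m) (λ j → ∑-point (f j) (λ x → 𝟙 (κ x ≡ᵇ a))) ⟩
    occ (κ ∘ f) a ∎
    where open ≡-Reasoning
  split : occ κ a ≡ fresh + occ (κ ∘ f) a
  split = trans (∑-cong′ (allFin k) split-term) (trans (∑-+ _ _ (allFin k)) (cong (fresh +_) in-image))

-- The number of injections f : Fin m → Fin k with κ ∘ f = c, choosing f 0, f 1, … in turn.
choices : {k : ℕ} → (Fin k → ℕ) → (m : ℕ) → (Fin m → ℕ) → ℕ
choices κ zero c = 1
choices κ (suc m) c = (occ κ (c zero) ∸ occ (c ∘ suc) (c zero)) * choices κ m (c ∘ suc)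

injective-vectors-with-values : {k : ℕ} (κ : Fin k → ℕ) (m : ℕ) (c : Fin m → ℕ) →
  ∑ (λ v → 𝟙 (injectiveᵇ (lookup v) ∧ hasValues κ (lookup v) c)) (allVecs k m) ≡ choices κ m c
injective-vectors-with-values κ zero c = refl
injective-vectors-with-values {k} κ (suc m) c =
  trans (∑-concatMap good (λ v → map (_∷ v) (allFin k)) (allVecs k m))
  (trans (∑-cong′ (allVecs k m) extend)
  (trans (∑-*ˡ D (λ v → 𝟙 (goodTail v)) (allVecs k m))
         (cong (D *_) (injective-vectors-with-values κ m (c ∘ suc)))))
  where
  good : Vec (Fin k) (suc m) → ℕ
  good v = 𝟙 (injectiveᵇ (lookup v) ∧ hasValues κ (lookup v) c)
  goodTail : Vec (Fin k) m → Bool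
  goodTail v = injectiveᵇ (lookup v) ∧ hasValues κ (lookup v) (c ∘ suc)
  D : ℕ
  D = occ κ (c zero) ∸ occ (c ∘ suc) (c zero)
  regroup : ∀ a b c d → (a * b) * (c * d) ≡ (b * d) * (a * c)
  regroup = solve-∀
  split-head : ∀ v x → good (x ∷ v) ≡ 𝟙 (goodTail v) * (𝟙 (notInImage x (lookup v)) * 𝟙 (κ x ≡ᵇ c zero))
  split-head v x =
    trans (𝟙-∧ (injectiveᵇ (lookup (x ∷ v))) _)
    (trans (cong₂ (λ p q → 𝟙 p * 𝟙 q) (injectiveᵇ-cons x v) (allB-allFin-suc (λ i → κ (lookup (x ∷ v) i) ≡ᵇ c i)))
    (trans (cong₂ _*_ (𝟙-∧ (notInImage x (lookup v)) _) (𝟙-∧ (κ x ≡ᵇ c zero) _))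
    (trans (regroup (𝟙 (notInImage x (lookup v))) (𝟙 (injectiveᵇ (lookup v)))
                   (𝟙 (κ x ≡ᵇ c zero)) (𝟙 (hasValues κ (lookup v) (c ∘ suc))))
           (cong (_* (𝟙 (notInImage x (lookup v)) * 𝟙 (κ x ≡ᵇ c zero)))
                 (sym (𝟙-∧ (injectiveᵇ (lookup v)) (hasValues κ (lookup v) (c ∘ suc))))))))
  heads : ∀ v → T (goodTail v) →
    ∑ (λ x → 𝟙 (notInImage x (lookup v)) * 𝟙 (κ x ≡ᵇ c zero)) (allFin k) ≡ D
  heads v h = trans (fresh-values κ (lookup v) (injectiveᵇ-sound _ (∧-fst h)) (c zero))
                    (cong (occ κ (c zero) ∸_)
                          (occ-cong _ _ (hasValues-sound κ (lookup v) (c ∘ suc) (∧-snd h)) (c zero)))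
  extend : ∀ v → ∑ good (map (_∷ v) (allFin k)) ≡ D * 𝟙 (goodTail v)
  extend v = trans (∑-map good (_∷ v) (allFin k))
             (trans (∑-cong′ (allFin k) (split-head v))
             (trans (∑-*ˡ (𝟙 (goodTail v)) _ (allFin k)) (by-cases (goodTail v) refl)))
    where
    by-cases : ∀ b → goodTail v ≡ b →
      𝟙 b * ∑ (λ x → 𝟙 (notInImage x (lookup v)) * 𝟙 (κ x ≡ᵇ c zero)) (allFin k) ≡ D * 𝟙 b
    by-cases true e = trans (+-identityʳ _) (trans (heads v (subst T (sym e) tt)) (sym (*-identityʳ D)))
    by-cases false _ = sym (*-zeroʳ D)

perms-with-values : {k : ℕ} (κ : Fin k → ℕ) (c : Fin k → ℕ) →
  ∑ (λ v → 𝟙 (hasValues κ v c)) (perms k) ≡ choices κ k c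
perms-with-values {k} κ c =
  trans (∑-filter (λ v → 𝟙 (hasValues κ v c)) isInjective (map lookup (allVecs k k)))
  (trans (∑-map (λ v → 𝟙 (isInjective v) * 𝟙 (hasValues κ v c)) lookup (allVecs k k))
  (trans (∑-cong′ (allVecs k k) (λ v → sym (𝟙-∧ (isInjective (lookup v)) _)))
         (injective-vectors-with-values κ k c)))

choices-closed : {k : ℕ} (κ : Fin k → ℕ) (m : ℕ) (c : Fin m → ℕ) (B : ℕ) → (∀ i → c i < B) →
  choices κ m c ≡ ∏< (λ a → occ κ a P′ occ c a) B
choices-closed κ zero c B _ = sym (trans (∏<-cong _ (λ _ → 1) B (λ a _ → refl)) (∏<-const1 B))
choices-closed κ (suc m) c B c<B =
  trans (cong (D *_) (choices-closed κ m (c ∘ suc) B (c<B ∘ suc)))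
        (sym (∏<-scale-one (λ a → occ κ a P′ occ (c ∘ suc) a) (λ a → occ κ a P′ occ c a) D (c zero) B (c<B zero)
                           at-head elsewhere))
  where
  D : ℕ
  D = occ κ (c zero) ∸ occ (c ∘ suc) (c zero)
  at-head : occ κ (c zero) P′ occ c (c zero) ≡ D * (occ κ (c zero) P′ occ (c ∘ suc) (c zero))
  at-head = cong (occ κ (c zero) P′_)
                 (trans (occ-suc c (c zero)) (cong (_+ occ (c ∘ suc) (c zero)) (𝟙-true (≡ᵇ-complete {c zero} refl))))
  elsewhere : ∀ a → ¬ a ≡ c zero → occ κ a P′ occ c a ≡ occ κ a P′ occ (c ∘ suc) a
  elsewhere a a≢c₀ = cong (occ κ a P′_)
                          (trans (occ-suc c a) (cong (_+ occ (c ∘ suc) a) (𝟙-false (λ t → a≢c₀ (sym (≡ᵇ-sound t))))))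

stabOrder : {k : ℕ} → (Fin k → ℕ) → ℕ
stabOrder {k} ρ = ∑ (λ u → 𝟙 (inStab ρ u)) (perms k)

inStab-complete : {k : ℕ} (ρ : Fin k → ℕ) (u : Fin k → Fin k) → (∀ x → ρ (u x) ≡ ρ x) → T (inStab ρ u)
inStab-complete ρ u = hasValues-complete ρ u ρ

valueBound : {k : ℕ} → (Fin k → ℕ) → ℕ
valueBound {k} ρ = suc (∑ ρ (allFin k))

valueBound-correct : {k : ℕ} (ρ : Fin k → ℕ) → ∀ i → ρ i < valueBound ρ
valueBound-correct {k} ρ i = s≤s (∑-term≤ ρ (allFin k) i (∈-allFin i))

stabOrder-formula : {k : ℕ} (ρ : Fin k → ℕ) (B : ℕ) → (∀ i → ρ i < B) → stabOrder ρ ≡ ∏< (λ a → occ ρ a !) B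
stabOrder-formula {k} ρ B ρ<B =
  trans (perms-with-values ρ ρ)
        (trans (choices-closed ρ k ρ B ρ<B) (∏<-cong _ _ B (λ a _ → nP′n≡n! (occ ρ a))))

stabOrder-positive : {k : ℕ} (ρ : Fin k → ℕ) → 0 < stabOrder ρ
stabOrder-positive ρ =
  subst (0 <_) (sym (stabOrder-formula ρ (valueBound ρ) (valueBound-correct ρ)))
        (∏<-positive (λ a → occ ρ a !) (valueBound ρ) (λ a → >-nonZero⁻¹ (occ ρ a !) {{occ ρ a !≢0}}))

cosetSize : {k : ℕ} (ρ : Fin k → ℕ) (w : Fin k → Fin k) → Inj w →
  ∑ (λ v → 𝟙 (hasValues ρ v (ρ ∘ w))) (perms k) ≡ stabOrder ρ
cosetSize {k} ρ w w-inj = begin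
  ∑ (λ v → 𝟙 (hasValues ρ v (ρ ∘ w))) (perms k)     ≡⟨ perms-with-values ρ (ρ ∘ w) ⟩
  choices ρ k (ρ ∘ w)                               ≡⟨ choices-closed ρ k (ρ ∘ w) B (λ i → valueBound-correct ρ (w i)) ⟩
  ∏< (λ a → occ ρ a P′ occ (ρ ∘ w) a) B             ≡⟨ ∏<-cong _ _ B (λ a _ → cong (occ ρ a P′_) (occ-reindex ρ w w-inj a)) ⟩
  ∏< (λ a → occ ρ a P′ occ ρ a) B                   ≡⟨ sym (choices-closed ρ k ρ B (valueBound-correct ρ)) ⟩
  choices ρ k ρ                                     ≡⟨ sym (perms-with-values ρ ρ) ⟩
  stabOrder ρ ∎
  where
  open ≡-Reasoning
  B : ℕ
  B = valueBound ρ

isInversion : {k : ℕ} → (Fin k → Fin k) → Fin k → Fin k → Bool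
isInversion w i j = (toℕ i <ᵇ toℕ j) ∧ (toℕ (w j) <ᵇ toℕ (w i))

isInversion-sound : {k : ℕ} (w : Fin k → Fin k) {i j : Fin k} →
  T (isInversion w i j) → toℕ i < toℕ j × toℕ (w j) < toℕ (w i)
isInversion-sound w {i} {j} h = <ᵇ⇒< _ _ (∧-fst h) , <ᵇ⇒< _ _ (∧-snd {toℕ i <ᵇ toℕ j} h)

isInversion-complete : {k : ℕ} (w : Fin k → Fin k) {i j : Fin k} →
  toℕ i < toℕ j → toℕ (w j) < toℕ (w i) → T (isInversion w i j)
isInversion-complete w i<j wj<wi = ∧-intro (<⇒<ᵇ i<j) (<⇒<ᵇ wj<wi)

len-as-∑ : {k : ℕ} (w : Fin k → Fin k) → len w ≡ ∑ (λ i → ∑ (λ j → 𝟙 (isInversion w i j)) (allFin k)) (allFin k)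
len-as-∑ {k} w =
  trans (count-as-∑ (λ ij → isInversion w (proj₁ ij) (proj₂ ij)) (cartesianProduct (allFin k) (allFin k)))
        (∑-cartesian (λ ij → 𝟙 (isInversion w (proj₁ ij) (proj₂ ij))) (allFin k) (allFin k))

len-ext : {k : ℕ} (w w' : Fin k → Fin k) → (∀ i → w i ≡ w' i) → len w ≡ len w'
len-ext {k} w w' w≗w' =
  trans (len-as-∑ w) (trans (∑-cong′ (allFin k) (λ i → ∑-cong′ (allFin k) (λ j → same-inversion i j)))
                            (sym (len-as-∑ w')))
  where
  same-inversion : ∀ i j → 𝟙 (isInversion w i j) ≡ 𝟙 (isInversion w' i j)
  same-inversion i j = cong₂ (λ a b → 𝟙 ((toℕ i <ᵇ toℕ j) ∧ (toℕ a <ᵇ toℕ b))) (w≗w' j) (w≗w' i)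

len-<-by-inversions : {k : ℕ} (w w' : Fin k → Fin k) → (∀ i j → T (isInversion w i j) → T (isInversion w' i j)) →
  (p q : Fin k) → ¬ T (isInversion w p q) → T (isInversion w' p q) → len w < len w'
len-<-by-inversions {k} w w' ⊆ p q p,q∉ p,q∈ =
  subst₂ _<_ (sym (len-as-∑ w)) (sym (len-as-∑ w'))
    (∑-mono-< (allFin k) (λ i _ → ∑-mono (allFin k) (λ j _ → 𝟙-mono (⊆ i j))) p (∈-allFin p)
      (∑-mono-< (allFin k) (λ j _ → 𝟙-mono (⊆ p j)) q (∈-allFin q)
        (subst₂ _<_ (sym (𝟙-false p,q∉)) (sym (𝟙-true p,q∈)) (s≤s z≤n))))

MinimiserOf : {A : Set} (p : A → Bool) (f : A → ℕ) (xs : List A) → Set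
MinimiserOf {A} p f xs = Σ A λ m → m ∈ xs × T (p m) × (∀ y → y ∈ xs → T (p y) → f m ≤ f y)

minimiser : {A : Set} (p : A → Bool) (f : A → ℕ) (xs : List A) →
  (∀ y → y ∈ xs → ¬ T (p y)) ⊎ MinimiserOf p f xs
minimiser p f [] = inj₁ (λ y ())
minimiser p f (x ∷ xs) with p x in px | minimiser p f xs
... | false | inj₁ none = inj₁ (λ { y (here refl) py → subst T px py ; y (there y∈) py → none y y∈ py })
... | false | inj₂ (m , m∈ , pm , m-min) =
  inj₂ (m , there m∈ , pm , λ { y (here refl) py → ⊥-elim (subst T px py) ; y (there y∈) py → m-min y y∈ py })
... | true | inj₁ none =
  inj₂ (x , here refl , subst T (sym px) tt , λ { y (here refl) _ → ≤-refl ; y (there y∈) py → ⊥-elim (none y y∈ py) })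
... | true | inj₂ (m , m∈ , pm , m-min) with f x ≤? f m
...   | yes x≤m = inj₂ (x , here refl , subst T (sym px) tt ,
                        λ { y (here refl) _ → ≤-refl ; y (there y∈) py → ≤-trans x≤m (m-min y y∈ py) })
...   | no x≰m = inj₂ (m , there m∈ , pm , λ { y (here refl) _ → <⇒≤ (≰⇒> x≰m) ; y (there y∈) py → m-min y y∈ py })

module AdjacentTransposition {k : ℕ} (a b : Fin k) (b≡a+1 : toℕ b ≡ suc (toℕ a)) where

  t : Fin k → Fin k
  t = transpose a b

  a<b : toℕ a < toℕ b
  a<b = subst (toℕ a <_) (sym b≡a+1) (n<1+n (toℕ a))

  data Position (x : Fin k) : Set where
    at-a : x ≡ a → Position x
    at-b : x ≡ b → Position x
    elsewhere : ¬ x ≡ a → ¬ x ≡ b → Position x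

  position : ∀ x → Position x
  position x with x ≟ᶠ a | x ≟ᶠ b
  ... | yes x≡a | _ = at-a x≡a
  ... | no _ | yes x≡b = at-b x≡b
  ... | no x≢a | no x≢b = elsewhere x≢a x≢b

  t-a : t a ≡ b
  t-a rewrite dec-true (a ≟ᶠ a) refl = refl

  t-b : t b ≡ a
  t-b rewrite dec-false (b ≟ᶠ a) (λ e → <⇒≢ a<b (cong toℕ (sym e))) | dec-true (b ≟ᶠ b) refl = refl

  t-elsewhere : ∀ x → ¬ x ≡ a → ¬ x ≡ b → t x ≡ x
  t-elsewhere x x≢a x≢b rewrite dec-false (x ≟ᶠ a) x≢a | dec-false (x ≟ᶠ b) x≢b = refl

  t-inj : Inj t
  t-inj x y e = trans (sym (transpose-inverse b a)) (trans (cong (transpose b a) e) (transpose-inverse b a))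

  t-stabilises : (ρ : Fin k → ℕ) → ρ a ≡ ρ b → ∀ x → ρ (t x) ≡ ρ x
  t-stabilises ρ ρa≡ρb x with position x
  ... | at-a refl = trans (cong ρ t-a) (sym ρa≡ρb)
  ... | at-b refl = trans (cong ρ t-b) ρa≡ρb
  ... | elsewhere x≢a x≢b = cong ρ (t-elsewhere x x≢a x≢b)

  t-monotone : ∀ x y → toℕ x < toℕ y → ¬ (x ≡ a × y ≡ b) → toℕ (t x) < toℕ (t y)
  t-monotone x y x<y not-ab with position x | position y
  ... | at-a refl | at-a refl = ⊥-elim (<-irrefl refl x<y)
  ... | at-a refl | at-b refl = ⊥-elim (not-ab (refl , refl))
  ... | at-a refl | elsewhere y≢a y≢b rewrite t-a | t-elsewhere y y≢a y≢b =
    ≤∧≢⇒< (subst (_≤ toℕ y) (sym b≡a+1) x<y) (λ e → y≢b (toℕ-injective (sym e)))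
  ... | at-b refl | at-a refl = ⊥-elim (<-asym a<b x<y)
  ... | at-b refl | at-b refl = ⊥-elim (<-irrefl refl x<y)
  ... | at-b refl | elsewhere y≢a y≢b rewrite t-b | t-elsewhere y y≢a y≢b = <-trans a<b x<y
  ... | elsewhere x≢a x≢b | at-a refl rewrite t-elsewhere x x≢a x≢b | t-a = <-trans x<y a<b
  ... | elsewhere x≢a x≢b | at-b refl rewrite t-elsewhere x x≢a x≢b | t-b =
    ≤∧≢⇒< (s≤s⁻¹ (subst (toℕ x <_) b≡a+1 x<y)) (λ e → x≢a (toℕ-injective e))
  ... | elsewhere x≢a x≢b | elsewhere y≢a y≢b rewrite t-elsewhere x x≢a x≢b | t-elsewhere y y≢a y≢b = x<y

-- A shortest element of a coset
-- S_ρ v is a minimal representative, so one exists.  Every minimal representative w is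
-- "level-sorted" (w⁻¹ is increasing on each level set of ρ), and a level-sorted w is
-- determined by ρ∘w through the position formula; hence each coset has exactly one.

module MinimalRepresentatives {k : ℕ} (ρ : Fin k → ℕ) (ρ-dec : Decreasing ρ) where

  ρ-<-index : ∀ {x y} → ρ y < ρ x → toℕ x < toℕ y
  ρ-<-index {x} {y} ρy<ρx = ≰⇒> (λ y≤x → <⇒≱ ρy<ρx (ρ-dec y x y≤x))

  LevelSorted : (Fin k → Fin k) → Set
  LevelSorted w = ∀ i j → ρ (w i) ≡ ρ (w j) → toℕ (w i) < toℕ (w j) → toℕ i < toℕ j

  AdjacentDescent : (Fin k → Fin k) → Set
  AdjacentDescent w = Σ (Fin k) λ p → Σ (Fin k) λ q →
    toℕ p < toℕ q × toℕ (w p) ≡ suc (toℕ (w q)) × ρ (w p) ≡ ρ (w q)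

  -- Any failure of level-sortedness can be narrowed down to an adjacent descent: walk up
  -- from the value w i through w i + 1, … ; `gap` bounds the remaining distance to w j.
  adjacent-descent : (w : Fin k → Fin k) → Inj w → (gap : ℕ) → ∀ i j →
    toℕ j < toℕ i → toℕ (w i) < toℕ (w j) → ρ (w i) ≡ ρ (w j) → toℕ (w j) ≤ toℕ (w i) + gap →
    AdjacentDescent w
  adjacent-descent w w-inj zero i j _ wi<wj _ wj≤wi+0 =
    ⊥-elim (<⇒≱ wi<wj (subst (toℕ (w j) ≤_) (+-identityʳ _) wj≤wi+0))
  adjacent-descent w w-inj (suc gap) i j j<i wi<wj ρwi≡ρwj wj≤ =
    step (<-cmp (toℕ p) (toℕ i))
    where
    next : Σ (Fin k) λ p → w p ≡ fromℕ< (≤-<-trans wi<wj (toℕ<n (w j)))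
    next = Inj-surjective w w-inj (fromℕ< (≤-<-trans wi<wj (toℕ<n (w j))))
    p : Fin k
    p = proj₁ next
    wp≡wi+1 : toℕ (w p) ≡ suc (toℕ (w i))
    wp≡wi+1 = trans (cong toℕ (proj₂ next)) (toℕ-fromℕ< _)
    -- ρ is constant on the values between w i and w j
    ρwp≡ρwi : ρ (w p) ≡ ρ (w i)
    ρwp≡ρwi = ≤-antisym (ρ-dec (w i) (w p) (subst (toℕ (w i) ≤_) (sym wp≡wi+1) (n≤1+n _)))
                        (subst (_≤ ρ (w p)) (sym ρwi≡ρwj) (ρ-dec (w p) (w j) (subst (_≤ toℕ (w j)) (sym wp≡wi+1) wi<wj)))
    step : _ → AdjacentDescent w
    step (tri< p<i _ _) = p , i , p<i , wp≡wi+1 , ρwp≡ρwi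
    step (tri≈ _ p≡i _) =
      ⊥-elim (<-irrefl (cong (toℕ ∘ w) (sym (toℕ-injective p≡i))) (subst (toℕ (w i) <_) (sym wp≡wi+1) (n<1+n _)))
    step (tri> _ _ i<p) =
      adjacent-descent w w-inj gap p j (<-trans j<i i<p) wp<wj (trans ρwp≡ρwi ρwi≡ρwj)
        (subst (toℕ (w j) ≤_) (trans (+-suc (toℕ (w i)) gap) (cong (_+ gap) (sym wp≡wi+1))) wj≤)
      where
      wp<wj : toℕ (w p) < toℕ (w j)
      wp<wj = ≤∧≢⇒< (subst (_≤ toℕ (w j)) (sym wp≡wi+1) wi<wj)
                    (λ e → <-irrefl (cong toℕ (w-inj j p (sym (toℕ-injective e)))) (<-trans j<i i<p))

  -- Swapping the two adjacent values of an adjacent descent stays in the coset and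
  -- removes exactly one inversion, so a minimal representative has no adjacent descent.
  minimal⇒no-adjacent-descent : (w : Fin k → Fin k) → Inj w → T (inMinReps ρ w) → ¬ AdjacentDescent w
  minimal⇒no-adjacent-descent w w-inj minimal (p , q , p<q , wp≡wq+1 , ρwp≡ρwq) = <⇒≱ shorter not-shorter
    where
    open AdjacentTransposition (w q) (w p) wp≡wq+1
    u-data : Σ (Fin k → Fin k) λ u → u ∈ perms k × (∀ x → u x ≡ t x)
    u-data = perms-complete t t-inj
    u : Fin k → Fin k
    u = proj₁ u-data
    u≗t : ∀ x → u x ≡ t x
    u≗t = proj₂ (proj₂ u-data)
    not-shorter : len w ≤ len (t ∘ w)
    not-shorter = subst (len w ≤_) (len-ext _ _ (λ x → u≗t (w x)))
      (≤ᵇ⇒≤ _ _ (→-sound (allB-sound _ (perms k) minimal u (proj₁ (proj₂ u-data)))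
                         (inStab-complete ρ u (λ x → trans (cong ρ (u≗t x)) (t-stabilises ρ (sym ρwp≡ρwq) x)))))
    fewer-inversions : ∀ i j → T (isInversion (t ∘ w) i j) → T (isInversion w i j)
    fewer-inversions i j inv with isInversion-sound (t ∘ w) inv
    ... | i<j , twj<twi with <-cmp (toℕ (w i)) (toℕ (w j))
    ...   | tri> _ _ wj<wi = isInversion-complete w i<j wj<wi
    ...   | tri≈ _ wi≡wj _ = ⊥-elim (<-irrefl (cong toℕ (w-inj i j (toℕ-injective wi≡wj))) i<j)
    ...   | tri< wi<wj _ _ = ⊥-elim (<-asym twj<twi (t-monotone (w i) (w j) wi<wj swapped-pair))
      where
      swapped-pair : ¬ (w i ≡ w q × w j ≡ w p)
      swapped-pair (wi≡wq , wj≡wp) =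
        <-asym p<q (subst₂ _<_ (cong toℕ (w-inj i q wi≡wq)) (cong toℕ (w-inj j p wj≡wp)) i<j)
    shorter : len (t ∘ w) < len w
    shorter = len-<-by-inversions (t ∘ w) w fewer-inversions p q
      (λ inv → <-asym (proj₂ (isInversion-sound (t ∘ w) inv))
                      (subst₂ _<_ (sym (cong toℕ t-b)) (sym (cong toℕ t-a)) (subst (toℕ (w q) <_) (sym wp≡wq+1) (n<1+n _))))
      (isInversion-complete w p<q (subst (toℕ (w q) <_) (sym wp≡wq+1) (n<1+n _)))

  minimal⇒sorted : (w : Fin k → Fin k) → Inj w → T (inMinReps ρ w) → LevelSorted w
  minimal⇒sorted w w-inj minimal i j ρwi≡ρwj wi<wj with toℕ i <? toℕ j
  ... | yes i<j = i<j
  ... | no i≮j = ⊥-elim (minimal⇒no-adjacent-descent w w-inj minimal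
                          (adjacent-descent w w-inj (toℕ (w j)) i j j<i wi<wj ρwi≡ρwj (m≤n+m _ _)))
    where
    j<i : toℕ j < toℕ i
    j<i = ≤∧≢⇒< (≮⇒≥ i≮j) (λ e → <-irrefl (cong (toℕ ∘ w) (sym (toℕ-injective e))) wi<wj)

  -- j comes before i in the positions of any level-sorted w with ρ∘w = τ
  precedes : (Fin k → ℕ) → Fin k → Fin k → Bool
  precedes τ j i = (τ i <ᵇ τ j) ∨ ((τ j ≡ᵇ τ i) ∧ (toℕ j <ᵇ toℕ i))

  precedes-cong : (τ τ' : Fin k → ℕ) → (∀ i → τ i ≡ τ' i) → ∀ j i → precedes τ j i ≡ precedes τ' j i
  precedes-cong τ τ' τ≗τ' j i =
    cong₂ (λ x y → (x <ᵇ y) ∨ ((y ≡ᵇ x) ∧ (toℕ j <ᵇ toℕ i))) (τ≗τ' i) (τ≗τ' j)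

  -- The position formula: w i = #{j : j precedes i}, so w is determined by ρ∘w.
  position-formula : (w : Fin k → Fin k) → Inj w → LevelSorted w →
    ∀ i → toℕ (w i) ≡ ∑ (λ j → 𝟙 (precedes (ρ ∘ w) j i)) (allFin k)
  position-formula w w-inj sorted i = begin
    toℕ (w i)                                             ≡⟨ sym (∑-initial k (toℕ (w i)) (<⇒≤ (toℕ<n (w i)))) ⟩
    ∑ (λ a → 𝟙 (toℕ a <ᵇ toℕ (w i))) (allFin k)           ≡⟨ sym (∑-reindex w w-inj (λ a → 𝟙 (toℕ a <ᵇ toℕ (w i)))) ⟩
    ∑ (λ j → 𝟙 (toℕ (w j) <ᵇ toℕ (w i))) (allFin k)       ≡⟨ ∑-cong′ (allFin k) (λ j → cong 𝟙 (T-ext _ _ (before j) (after j))) ⟩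
    ∑ (λ j → 𝟙 (precedes (ρ ∘ w) j i)) (allFin k) ∎
    where
    open ≡-Reasoning
    before : ∀ j → T (toℕ (w j) <ᵇ toℕ (w i)) → T (precedes (ρ ∘ w) j i)
    before j h with ρ (w i) <? ρ (w j)
    ... | yes ρwi<ρwj = Equivalence.from T-∨ (inj₁ (<⇒<ᵇ ρwi<ρwj))
    ... | no ρwi≮ρwj = Equivalence.from T-∨ (inj₂ (∧-intro (≡ᵇ-complete ρwj≡ρwi)
                                                      (<⇒<ᵇ (sorted j i ρwj≡ρwi wj<wi))))
      where
      wj<wi : toℕ (w j) < toℕ (w i)
      wj<wi = <ᵇ⇒< _ _ h
      ρwj≡ρwi : ρ (w j) ≡ ρ (w i)
      ρwj≡ρwi = ≤-antisym (≮⇒≥ ρwi≮ρwj) (ρ-dec (w j) (w i) (<⇒≤ wj<wi))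
    after : ∀ j → T (precedes (ρ ∘ w) j i) → T (toℕ (w j) <ᵇ toℕ (w i))
    after j h with Equivalence.to T-∨ h
    ... | inj₁ ρwi<ρwj = <⇒<ᵇ (ρ-<-index (<ᵇ⇒< _ _ ρwi<ρwj))
    ... | inj₂ same-level with <-cmp (toℕ (w j)) (toℕ (w i))
    ...   | tri< wj<wi _ _ = <⇒<ᵇ wj<wi
    ...   | tri≈ _ wj≡wi _ = ⊥-elim (<-irrefl (cong toℕ (w-inj j i (toℕ-injective wj≡wi))) j<i)
      where
      j<i : toℕ j < toℕ i
      j<i = <ᵇ⇒< _ _ (∧-snd {ρ (w j) ≡ᵇ ρ (w i)} same-level)
    ...   | tri> _ _ wi<wj = ⊥-elim (<-asym j<i (sorted i j (sym (≡ᵇ-sound (∧-fst same-level))) wi<wj))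
      where
      j<i : toℕ j < toℕ i
      j<i = <ᵇ⇒< _ _ (∧-snd {ρ (w j) ≡ᵇ ρ (w i)} same-level)

  sorted-unique : (w w' : Fin k → Fin k) → Inj w → Inj w' → LevelSorted w → LevelSorted w' →
    (∀ i → ρ (w i) ≡ ρ (w' i)) → ∀ i → w i ≡ w' i
  sorted-unique w w' w-inj w'-inj sorted sorted' same-values i = toℕ-injective (begin
    toℕ (w i)                                      ≡⟨ position-formula w w-inj sorted i ⟩
    ∑ (λ j → 𝟙 (precedes (ρ ∘ w) j i)) (allFin k)  ≡⟨ ∑-cong′ (allFin k) (λ j → cong 𝟙 (precedes-cong _ _ same-values j i)) ⟩
    ∑ (λ j → 𝟙 (precedes (ρ ∘ w') j i)) (allFin k) ≡⟨ sym (position-formula w' w'-inj sorted' i) ⟩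
    toℕ (w' i) ∎)
    where open ≡-Reasoning

  inMinReps-ext : (w w' : Fin k → Fin k) → (∀ i → w i ≡ w' i) → inMinReps ρ w ≡ inMinReps ρ w'
  inMinReps-ext w w' w≗w' = allB-cong _ _ (perms k) (λ u →
    cong₂ (λ x y → not (inStab ρ u) ∨ (x ≤ᵇ y)) (len-ext w w' w≗w') (len-ext (u ∘ w) (u ∘ w') (cong u ∘ w≗w')))

  minimal-exists : (v : Fin k → Fin k) → v ∈ perms k →
    Σ (Fin k → Fin k) λ w → w ∈ perms k × T (inMinReps ρ w) × (∀ i → ρ (w i) ≡ ρ (v i))
  minimal-exists v v∈ with minimiser (λ w → hasValues ρ w (ρ ∘ v)) len (perms k)
  ... | inj₁ none = ⊥-elim (none v v∈ (hasValues-complete ρ v (ρ ∘ v) (λ _ → refl)))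
  ... | inj₂ (w , w∈ , in-coset , shortest) =
    w , w∈ , allB-complete _ (perms k) (λ u u∈ → →-complete (λ u∈S → ≤⇒≤ᵇ (no-shorter u u∈ u∈S))) , w-values
    where
    w-values : ∀ i → ρ (w i) ≡ ρ (v i)
    w-values = hasValues-sound ρ w (ρ ∘ v) in-coset
    no-shorter : ∀ u → u ∈ perms k → T (inStab ρ u) → len w ≤ len (u ∘ w)
    no-shorter u u∈ u∈S = subst (len w ≤_) (len-ext _ _ uw'≗uw) (shortest uw' uw'∈ (hasValues-complete ρ uw' (ρ ∘ v) uw'-values))
      where
      uw-perm : Σ (Fin k → Fin k) λ w' → w' ∈ perms k × (∀ i → w' i ≡ u (w i))
      uw-perm = perms-complete (u ∘ w) (Inj-∘ u w (perms-inj u∈) (perms-inj w∈))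
      uw' : Fin k → Fin k
      uw' = proj₁ uw-perm
      uw'∈ : uw' ∈ perms k
      uw'∈ = proj₁ (proj₂ uw-perm)
      uw'≗uw : ∀ i → uw' i ≡ u (w i)
      uw'≗uw = proj₂ (proj₂ uw-perm)
      uw'-values : ∀ i → ρ (uw' i) ≡ ρ (v i)
      uw'-values i = trans (cong ρ (uw'≗uw i)) (trans (hasValues-sound ρ u ρ u∈S (w i)) (w-values i))

  exactly-one-minimal : (v : Fin k → Fin k) → v ∈ perms k →
    ∑ (λ w → 𝟙 (inMinReps ρ w ∧ hasValues ρ w (ρ ∘ v))) (perms k) ≡ 1
  exactly-one-minimal v v∈ with minimal-exists v v∈
  ... | w★ , w★∈ , w★-minimal , w★-values =
    trans (∑-cong (perms k) (λ w w∈ → cong 𝟙 (T-ext _ _ (is-w★ w (perms-inj w∈)) (from-w★ w))))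
          (perms-unique w★ w★-inj)
    where
    w★-inj : Inj w★
    w★-inj = perms-inj w★∈
    is-w★ : ∀ w → Inj w → T (inMinReps ρ w ∧ hasValues ρ w (ρ ∘ v)) → T (w ≗ᵇ w★)
    is-w★ w w-inj h = ≗ᵇ-complete (sorted-unique w w★ w-inj w★-inj
      (minimal⇒sorted w w-inj (∧-fst h)) (minimal⇒sorted w★ w★-inj w★-minimal)
      (λ i → trans (hasValues-sound ρ w (ρ ∘ v) (∧-snd {inMinReps ρ w} h) i) (sym (w★-values i))))
    from-w★ : ∀ w → T (w ≗ᵇ w★) → T (inMinReps ρ w ∧ hasValues ρ w (ρ ∘ v))
    from-w★ w h = ∧-intro (subst T (sym (inMinReps-ext w w★ w≗w★)) w★-minimal)
                          (hasValues-complete ρ w (ρ ∘ v) (λ i → trans (cong ρ (w≗w★ i)) (w★-values i)))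
      where
      w≗w★ : ∀ i → w i ≡ w★ i
      w≗w★ = ≗ᵇ-sound h

  hasValues-sym : (w v : Fin k → Fin k) → hasValues ρ w (ρ ∘ v) ≡ hasValues ρ v (ρ ∘ w)
  hasValues-sym w v = T-ext _ _ (λ h → hasValues-complete ρ v (ρ ∘ w) (λ i → sym (hasValues-sound ρ w (ρ ∘ v) h i)))
                                (λ h → hasValues-complete ρ w (ρ ∘ v) (λ i → sym (hasValues-sound ρ v (ρ ∘ w) h i)))

  coset-decomposition : (g : (Fin k → ℕ) → ℕ) → Extensional g →
    ∑ (λ v → g (ρ ∘ v)) (perms k) ≡ ∑ (λ w → 𝟙 (inMinReps ρ w) * g (ρ ∘ w)) (perms k) * stabOrder ρ
  coset-decomposition g g-ext =
    trans (double-count (λ v → g (ρ ∘ v)) (λ v w → 𝟙 (inMinReps ρ w ∧ hasValues ρ w (ρ ∘ v))) (perms k) (perms k)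
                        exactly-one-minimal)
    (trans (∑-cong (perms k) (λ w w∈ → coset-of w (perms-inj w∈)))
           (∑-*ʳ (stabOrder ρ) (λ w → 𝟙 (inMinReps ρ w) * g (ρ ∘ w)) (perms k)))
    where
    per-element : ∀ w v → 𝟙 (inMinReps ρ w ∧ hasValues ρ w (ρ ∘ v)) * g (ρ ∘ v)
                        ≡ 𝟙 (inMinReps ρ w) * g (ρ ∘ w) * 𝟙 (hasValues ρ v (ρ ∘ w))
    per-element w v rewrite 𝟙-∧ (inMinReps ρ w) (hasValues ρ w (ρ ∘ v)) | hasValues-sym w v
      with hasValues ρ v (ρ ∘ w) in eq
    ... | true = trans (cong (_* g (ρ ∘ v)) (*-identityʳ (𝟙 (inMinReps ρ w))))
                       (trans (cong (𝟙 (inMinReps ρ w) *_) (g-ext _ _ (hasValues-sound ρ v (ρ ∘ w) (subst T (sym eq) tt))))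
                              (sym (*-identityʳ (𝟙 (inMinReps ρ w) * g (ρ ∘ w)))))
    ... | false = trans (cong (_* g (ρ ∘ v)) (*-zeroʳ (𝟙 (inMinReps ρ w)))) (sym (*-zeroʳ (𝟙 (inMinReps ρ w) * g (ρ ∘ w))))
    coset-of : ∀ w → Inj w → ∑ (λ v → 𝟙 (inMinReps ρ w ∧ hasValues ρ w (ρ ∘ v)) * g (ρ ∘ v)) (perms k)
                            ≡ 𝟙 (inMinReps ρ w) * g (ρ ∘ w) * stabOrder ρ
    coset-of w w-inj = trans (∑-cong′ (perms k) (per-element w))
                       (trans (∑-*ˡ (𝟙 (inMinReps ρ w) * g (ρ ∘ w)) (λ v → 𝟙 (hasValues ρ v (ρ ∘ w))) (perms k))
                              (cong (𝟙 (inMinReps ρ w) * g (ρ ∘ w) *_) (cosetSize ρ w w-inj)))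

module CongruenceCount {k n : ℕ} .{{_ : NonZero n}} (lam mu : Fin k → ℕ) where

  solves : (Fin k → Fin k) → (Fin k → ℕ) → Bool
  solves w τ = allB (λ i → ((mu (w i) + τ i) % n) ≡ᵇ (lam i % n)) (allFin k)

  solves-mod : (w : Fin k → Fin k) (τ τ' : Fin k → ℕ) → (∀ i → τ i % n ≡ τ' i % n) → solves w τ ≡ solves w τ'
  solves-mod w τ τ' same-residues = allB-cong _ _ (allFin k) (λ i → cong (_≡ᵇ (lam i % n)) (begin
    (mu (w i) + τ i) % n             ≡⟨ %-distribˡ-+ (mu (w i)) (τ i) n ⟩
    (mu (w i) % n + τ i % n) % n     ≡⟨ cong (λ r → (mu (w i) % n + r) % n) (same-residues i) ⟩
    (mu (w i) % n + τ' i % n) % n    ≡⟨ sym (%-distribˡ-+ (mu (w i)) (τ' i) n) ⟩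
    (mu (w i) + τ' i) % n ∎))
    where open ≡-Reasoning

  solves-ext : (w : Fin k → Fin k) → Extensional (λ τ → 𝟙 (solves w τ))
  solves-ext w τ τ' τ≗τ' = cong 𝟙 (solves-mod w τ τ' (λ i → cong (_% n) (τ≗τ' i)))

  pairCount : (Fin k → ℕ) → ℕ
  pairCount nu = ∑ (λ w → 𝟙 (inMinReps mu w) * ∑ (λ v → 𝟙 (solves w (nu ∘ v))) (perms k)) (perms k)

  N-as-∑ : (nu : Fin k → ℕ) →
    N k n lam mu nu ≡ ∑ (λ w → 𝟙 (inMinReps mu w) * ∑ (λ w' → 𝟙 (inMinReps nu w') * 𝟙 (solves w (nu ∘ w'))) (perms k)) (perms k)
  N-as-∑ nu =
    trans (count-as-∑ _ (cartesianProduct (perms k) (perms k)))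
    (trans (∑-cartesian _ (perms k) (perms k))
           (∑-cong′ (perms k) (λ w → trans (∑-cong′ (perms k) (λ w' → split-test w w'))
                                           (∑-*ˡ (𝟙 (inMinReps mu w)) _ (perms k)))))
    where
    split-test : ∀ w w' → 𝟙 (inMinReps mu w ∧ inMinReps nu w' ∧ solves w (nu ∘ w'))
                        ≡ 𝟙 (inMinReps mu w) * (𝟙 (inMinReps nu w') * 𝟙 (solves w (nu ∘ w')))
    split-test w w' = trans (𝟙-∧ (inMinReps mu w) _) (cong (𝟙 (inMinReps mu w) *_) (𝟙-∧ (inMinReps nu w') _))

  N-times-stabOrder : (nu : Fin k → ℕ) → Decreasing nu → N k n lam mu nu * stabOrder nu ≡ pairCount nu
  N-times-stabOrder nu nu-dec =
    trans (cong (_* stabOrder nu) (N-as-∑ nu))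
    (trans (sym (∑-*ʳ (stabOrder nu) _ (perms k)))
           (∑-cong′ (perms k) (λ w → trans (*-assoc (𝟙 (inMinReps mu w)) _ (stabOrder nu))
              (cong (𝟙 (inMinReps mu w) *_) (sym (coset-decomposition (λ τ → 𝟙 (solves w τ)) (solves-ext w)))))))
    where open MinimalRepresentatives nu nu-dec

  pairCount-invariant : (nu nuc : Fin k → ℕ) (π : Fin k → Fin k) → Inj π →
    (∀ i → nuc i % n ≡ nu (π i) % n) → pairCount nu ≡ pairCount nuc
  pairCount-invariant nu nuc π π-inj same-residues =
    ∑-cong′ (perms k) (λ w → cong (𝟙 (inMinReps mu w) *_) (begin
      ∑ (λ v → 𝟙 (solves w (nu ∘ v))) (perms k)
        ≡⟨ sym (∑perms-translate π π-inj (λ v → 𝟙 (solves w (nu ∘ v))) (λ f f' f≗f' → solves-ext w _ _ (cong nu ∘ f≗f'))) ⟩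
      ∑ (λ v → 𝟙 (solves w (nu ∘ π ∘ v))) (perms k)
        ≡⟨ ∑-cong′ (perms k) (λ v → cong 𝟙 (solves-mod w _ _ (λ i → sym (same-residues (v i))))) ⟩
      ∑ (λ v → 𝟙 (solves w (nuc ∘ v))) (perms k) ∎))
    where open ≡-Reasoning

∏<-cons : (f : ℕ → ℕ) (m : ℕ) → ∏< f (suc m) ≡ f 0 * ∏< (f ∘ suc) m
∏<-cons f zero = *-comm 1 (f 0)
∏<-cons f (suc m) = trans (cong (_* f (suc m)) (∏<-cons f m)) (*-assoc (f 0) _ _)

∏<-* : (f g : ℕ → ℕ) (B : ℕ) → ∏< (λ a → f a * g a) B ≡ ∏< f B * ∏< g B
∏<-* f g zero = refl
∏<-* f g (suc B) = trans (cong (_* (f B * g B)) (∏<-* f g B)) (interchange (∏< f B) (∏< g B) (f B) (g B))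
  where
  interchange : ∀ p q r s → p * q * (r * s) ≡ p * r * (q * s)
  interchange = solve-∀

∏<-swap : (g : ℕ → ℕ → ℕ) (I J : ℕ) → ∏< (λ i → ∏< (g i) J) I ≡ ∏< (λ j → ∏< (λ i → g i j) I) J
∏<-swap g zero J = sym (∏<-const1 J)
∏<-swap g (suc I) J =
  trans (cong (_* ∏< (g I) J) (∏<-swap g I J)) (sym (∏<-* (λ j → ∏< (λ i → g i j) I) (g I) J))

∏<-+ : (f : ℕ → ℕ) (p q : ℕ) → ∏< f (p + q) ≡ ∏< f p * ∏< (λ i → f (p + i)) q
∏<-+ f p zero = trans (cong (∏< f) (+-identityʳ p)) (sym (*-identityʳ _))
∏<-+ f p (suc q) = trans (cong (∏< f) (+-suc p q)) (trans (cong (_* f (p + q)) (∏<-+ f p q)) (*-assoc (∏< f p) _ _))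

∏<-blocks : (f : ℕ → ℕ) (n J : ℕ) → ∏< f (J * n) ≡ ∏< (λ j → ∏< (λ i → f (j * n + i)) n) J
∏<-blocks f n zero = refl
∏<-blocks f n (suc J) =
  trans (cong (∏< f) (+-comm n (J * n)))
        (trans (∏<-+ f (J * n) n) (cong (_* ∏< (λ i → f (J * n + i)) n) (∏<-blocks f n J)))

∑-upTo-suc : (f : ℕ → ℕ) (m : ℕ) → ∑ f (upTo (suc m)) ≡ ∑ f (upTo m) + f m
∑-upTo-suc f m = trans (cong (∑ f) (sym (upTo-∷ʳ m)))
                       (trans (∑-++ f (upTo m) (m ∷ [])) (cong (∑ f (upTo m) +_) (+-identityʳ (f m))))

product-upTo : (f : ℕ → ℕ) (m : ℕ) → product (map f (upTo m)) ≡ ∏< f m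
product-upTo f zero = refl
product-upTo f (suc m) =
  trans (cong (product ∘ map f) (sym (upTo-∷ʳ m)))
  (trans (cong product (map-++ f (upTo m) (m ∷ [])))
  (trans (product-++ (map f (upTo m)) (f m ∷ []))
         (cong₂ _*_ (product-upTo f m) (*-identityʳ (f m)))))

∑-upTo-point : (j₀ m : ℕ) → ∑ (λ j → 𝟙 (j ≡ᵇ j₀)) (upTo m) ≡ 𝟙 (j₀ <ᵇ m)
∑-upTo-point j₀ zero = refl
∑-upTo-point j₀ (suc m) =
  trans (∑-upTo-suc (λ j → 𝟙 (j ≡ᵇ j₀)) m)
        (trans (cong (_+ 𝟙 (m ≡ᵇ j₀)) (∑-upTo-point j₀ m))
               (sym (𝟙-split (j₀ <ᵇ suc m) (j₀ <ᵇ m) (m ≡ᵇ j₀) cover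
                      (λ h → <⇒<ᵇ (m<n⇒m<1+n (<ᵇ⇒< j₀ m h)))
                      (λ h → <⇒<ᵇ (subst (_< suc m) (≡ᵇ-sound h) (n<1+n m)))
                      (λ h e → <-irrefl (sym (≡ᵇ-sound e)) (<ᵇ⇒< j₀ m h)))))
  where
  cover : T (j₀ <ᵇ suc m) → T (j₀ <ᵇ m) ⊎ T (m ≡ᵇ j₀)
  cover h with m≤n⇒m<n∨m≡n (s≤s⁻¹ (<ᵇ⇒< j₀ (suc m) h))
  ... | inj₁ j₀<m = inj₁ (<⇒<ᵇ j₀<m)
  ... | inj₂ j₀≡m = inj₂ (≡ᵇ-complete (sym j₀≡m))

binomial-factorials : ∀ a b → b ≤ a → (a C b) * (b ! * (a ∸ b) !) ≡ a !
binomial-factorials a b b≤a =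
  trans (cong (_* (b ! * (a ∸ b) !)) (nCk≡n!/k![n-k]! b≤a)) (m/n*n≡m {{b !* (a ∸ b) !≢0}} (k![n∸k]!∣n! b≤a))

multinomial-factorials : (bs : List ℕ) (a : ℕ) → ∑ id bs ≡ a → multinomial a bs * product (map _! bs) ≡ a !
multinomial-factorials [] a refl = refl
multinomial-factorials (b ∷ bs) a refl =
  trans (regroup (a C b) (multinomial (a ∸ b) bs) (b !) (product (map _! bs)))
  (trans (cong (λ z → (a C b) * (b ! * z)) (multinomial-factorials bs (a ∸ b) (sym (m+n∸m≡n b (∑ id bs)))))
         (binomial-factorials a b (m≤m+n b _)))
  where
  regroup : ∀ p q r s → p * q * (r * s) ≡ p * (r * (q * s))
  regroup = solve-∀

module StabiliserRatio {k : ℕ} (n' : ℕ) (nu nuc : Fin k → ℕ) where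

  n : ℕ
  n = suc n'

  S : ℕ
  S = sumℕ nu

  classes : ℕ → List ℕ
  classes i = multsMod n i nu

  classFactor : ℕ → ℕ
  classFactor i = ∏< (λ j → occ nu (i + j * n) !) (suc S)

  M : ℕ
  M = multinomial (mult n nuc) (classes 0) * prodRange n (λ i → multinomial (mult i nuc) (classes i))

  nu≤S : ∀ x → nu x ≤ S
  nu≤S x = subst (nu x ≤_) (∑-as-foldr (allFin k)) (∑-term≤ nu (allFin k) x (∈-allFin x))
    where
    ∑-as-foldr : (xs : List (Fin k)) → ∑ nu xs ≡ foldr (λ i s → nu i + s) 0 xs
    ∑-as-foldr [] = refl
    ∑-as-foldr (x ∷ xs) = cong (nu x +_) (∑-as-foldr xs)

  division-unique : ∀ i j y → i < n → (y ≡ᵇ i + j * n) ≡ ((y % n ≡ᵇ i) ∧ (j ≡ᵇ y / n))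
  division-unique i j y i<n = T-ext _ _ forward backward
    where
    forward : T (y ≡ᵇ i + j * n) → T ((y % n ≡ᵇ i) ∧ (j ≡ᵇ y / n))
    forward h = ∧-intro (≡ᵇ-complete y%n≡i)
                        (≡ᵇ-complete (*-cancelʳ-≡ j (y / n) n (+-cancelˡ-≡ i _ _
                          (trans (sym y≡i+jn) (trans (m≡m%n+[m/n]*n y n) (cong (_+ y / n * n) y%n≡i))))))
      where
      y≡i+jn : y ≡ i + j * n
      y≡i+jn = ≡ᵇ-sound h
      y%n≡i : y % n ≡ i
      y%n≡i = trans (cong (_% n) y≡i+jn) (trans ([m+kn]%n≡m%n i j n) (m<n⇒m%n≡m i<n))
    backward : T ((y % n ≡ᵇ i) ∧ (j ≡ᵇ y / n)) → T (y ≡ᵇ i + j * n)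
    backward h = ≡ᵇ-complete {y} {i + j * n} (trans (m≡m%n+[m/n]*n y n)
                   (cong₂ (λ r q → r + q * n) (≡ᵇ-sound {y % n} {i} (∧-fst h))
                                              (sym (≡ᵇ-sound {j} {y / n} (∧-snd {y % n ≡ᵇ i} h)))))

  classes-sum : ∀ i → i < n → ∑ id (classes i) ≡ occ ((_% n) ∘ nu) i
  classes-sum i i<n = begin
    ∑ id (classes i)
      ≡⟨ trans (∑-map id (λ j → mult (i + j * n) nu) (upTo (suc S)))
               (∑-cong′ (upTo (suc S)) (λ j → mult≡occ (i + j * n) nu)) ⟩
    ∑ (λ j → ∑ (λ x → 𝟙 (nu x ≡ᵇ i + j * n)) (allFin k)) (upTo (suc S))
      ≡⟨ ∑-swap (λ j x → 𝟙 (nu x ≡ᵇ i + j * n)) (upTo (suc S)) (allFin k) ⟩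
    ∑ (λ x → ∑ (λ j → 𝟙 (nu x ≡ᵇ i + j * n)) (upTo (suc S))) (allFin k)
      ≡⟨ ∑-cong′ (allFin k) (λ x → ∑-cong′ (upTo (suc S)) (λ j →
           trans (cong 𝟙 (division-unique i j (nu x) i<n)) (𝟙-∧ (nu x % n ≡ᵇ i) (j ≡ᵇ nu x / n)))) ⟩
    ∑ (λ x → ∑ (λ j → 𝟙 (nu x % n ≡ᵇ i) * 𝟙 (j ≡ᵇ nu x / n)) (upTo (suc S))) (allFin k)
      ≡⟨ ∑-cong′ (allFin k) (λ x → trans (∑-*ˡ (𝟙 (nu x % n ≡ᵇ i)) _ (upTo (suc S)))
                                         (cong (𝟙 (nu x % n ≡ᵇ i) *_) (quotient-in-range x))) ⟩
    ∑ (λ x → 𝟙 (nu x % n ≡ᵇ i) * 1) (allFin k)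
      ≡⟨ ∑-cong′ (allFin k) (λ x → *-identityʳ _) ⟩
    occ ((_% n) ∘ nu) i ∎
    where
    open ≡-Reasoning
    quotient-in-range : ∀ x → ∑ (λ j → 𝟙 (j ≡ᵇ nu x / n)) (upTo (suc S)) ≡ 1
    quotient-in-range x = trans (∑-upTo-point (nu x / n) (suc S))
                                (𝟙-true (<⇒<ᵇ (s≤s (≤-trans (m/n≤m (nu x) n) (nu≤S x)))))

  classes-factorials : ∀ i → product (map _! (classes i)) ≡ classFactor i
  classes-factorials i =
    trans (cong product (sym (map-∘ {g = _!} {f = λ j → mult (i + j * n) nu} (upTo (suc S)))))
          (trans (product-upTo (λ j → mult (i + j * n) nu !) (suc S))
                 (∏<-cong _ _ (suc S) (λ j _ → cong _! (mult≡occ (i + j * n) nu))))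

  stabOrder-nu : stabOrder nu ≡ ∏< classFactor n
  stabOrder-nu =
    trans (stabOrder-formula nu (suc S * n) (λ x → ≤-trans (s≤s (nu≤S x)) (m≤m*n (suc S) n)))
    (trans (∏<-blocks (λ a → occ nu a !) n (suc S))
    (trans (sym (∏<-swap (λ i j → occ nu (j * n + i) !) n (suc S)))
           (∏<-cong _ _ n (λ i _ → ∏<-cong _ _ (suc S) (λ j _ → cong (λ a → occ nu a !) (+-comm (j * n) i))))))

  stabOrder-nuc : (∀ x → 0 < nuc x × nuc x ≤ n) → stabOrder nuc ≡ mult n nuc ! * ∏< (λ i → mult (suc i) nuc !) n'
  stabOrder-nuc in-range =
    trans (stabOrder-formula nuc (suc n) (λ x → s≤s (proj₂ (in-range x))))
    (trans (∏<-cons (λ a → occ nuc a !) n)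
    (trans (cong (λ z → z ! * ∏< (λ a → occ nuc (suc a) !) n) no-zeros)
    (trans (+-identityʳ _)
    (trans (*-comm (∏< (λ i → occ nuc (suc i) !) n') (occ nuc n !))
           (sym (cong₂ _*_ (cong _! (mult≡occ n nuc)) (∏<-cong _ _ n' (λ i _ → cong _! (mult≡occ (suc i) nuc)))))))))
    where
    no-zeros : occ nuc 0 ≡ 0
    no-zeros = trans (∑-cong′ (allFin k) (λ x → 𝟙-false (λ t → <⇒≢ (proj₁ (in-range x)) (sym (≡ᵇ-sound t)))))
                     (∑-zero (allFin k))

  class-multinomial : ∀ c i → i < n → mult c nuc ≡ occ ((_% n) ∘ nu) i →
    multinomial (mult c nuc) (classes i) * classFactor i ≡ mult c nuc !
  class-multinomial c i i<n same-size =
    trans (cong (multinomial (mult c nuc) (classes i) *_) (sym (classes-factorials i)))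
          (multinomial-factorials (classes i) (mult c nuc) (trans (classes-sum i i<n) (sym same-size)))

  stabOrder-ratio : (∀ x → 0 < nuc x × nuc x ≤ n) →
    (∀ c → 0 < c → c ≤ n → mult c nuc ≡ occ ((_% n) ∘ nu) (c % n)) →
    stabOrder nuc ≡ M * stabOrder nu
  stabOrder-ratio in-range same-size = sym (begin
    M * stabOrder nu
      ≡⟨ cong₂ _*_ (cong (M₀ *_) (product-upTo M₊ n')) (trans stabOrder-nu (∏<-cons classFactor n')) ⟩
    M₀ * ∏< M₊ n' * (classFactor 0 * ∏< (classFactor ∘ suc) n')
      ≡⟨ interchange M₀ (∏< M₊ n') (classFactor 0) (∏< (classFactor ∘ suc) n') ⟩
    M₀ * classFactor 0 * (∏< M₊ n' * ∏< (classFactor ∘ suc) n')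
      ≡⟨ cong₂ _*_ (class-multinomial n 0 (s≤s z≤n) (trans (same-size n (s≤s z≤n) ≤-refl) (cong (occ ((_% n) ∘ nu)) (n%n≡0 n))))
                   (sym (∏<-* M₊ (classFactor ∘ suc) n')) ⟩
    mult n nuc ! * ∏< (λ i → M₊ i * classFactor (suc i)) n'
      ≡⟨ cong (mult n nuc ! *_) (∏<-cong _ _ n' (λ i i<n' → class-multinomial (suc i) (suc i) (s≤s i<n')
           (trans (same-size (suc i) (s≤s z≤n) (s≤s (<⇒≤ i<n'))) (cong (occ ((_% n) ∘ nu)) (m<n⇒m%n≡m (s≤s i<n')))))) ⟩
    mult n nuc ! * ∏< (λ i → mult (suc i) nuc !) n'
      ≡⟨ sym (stabOrder-nuc in-range) ⟩
    stabOrder nuc ∎)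
    where
    open ≡-Reasoning
    M₀ : ℕ
    M₀ = multinomial (mult n nuc) (classes 0)
    M₊ : ℕ → ℕ
    M₊ i = multinomial (mult (suc i) nuc) (classes (suc i))
    interchange : ∀ a b c d → a * b * (c * d) ≡ a * c * (b * d)
    interchange = solve-∀

-- The orbit ν Ŝ_k: a point σ of the orbit is ν read along an affine permutation w, so
-- σ_i ≡ ν_{w(i) mod k} (mod n), and i ↦ w(i) mod k is a permutation of Fin k.

module AffineOrbit where
  open Int using (+_; -[1+_]; _-_; -_) renaming (_+_ to _+ℤ_; _*_ to _*ℤ_)

  ≡-mod-from-ℤ : (a b n : ℕ) .{{_ : NonZero n}} (q : ℤ) → + a ≡ + b - q *ℤ + n → a % n ≡ b % n
  ≡-mod-from-ℤ a b n (+ q) a≡b-qn = sym (trans (cong (_% n) b≡a+qn) ([m+kn]%n≡m%n a q n))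
    where
    rearrange : ∀ (y z : ℤ) → y ≡ (y - z) +ℤ z
    rearrange = IntRing.solve-∀
    b≡a+qn : b ≡ a + q * n
    b≡a+qn = IntP.+-injective (trans (rearrange (+ b) (+ q *ℤ + n))
               (trans (cong (_+ℤ (+ q *ℤ + n)) (sym a≡b-qn)) (cong ((+ a) +ℤ_) (sym (IntP.pos-* q n)))))
  ≡-mod-from-ℤ a b n -[1+ q ] a≡b-qn = trans (cong (_% n) a≡b+qn) ([m+kn]%n≡m%n b (suc q) n)
    where
    rearrange : ∀ (y z : ℤ) → y - (- z) ≡ y +ℤ z
    rearrange = IntRing.solve-∀
    a≡b+qn : a ≡ b + suc q * n
    a≡b+qn = IntP.+-injective (trans a≡b-qn (trans (cong (λ z → + b - z) (sym (IntP.neg-distribˡ-* (+ suc q) (+ n))))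
               (trans (rearrange (+ b) (+ suc q *ℤ + n)) (cong ((+ b) +ℤ_) (sym (IntP.pos-* (suc q) n))))))

  module _ (k : ℕ) .{{_ : NonZero k}} (w : ℤ → ℤ) (w-affine : IsAffinePerm k w) where

    w⁻¹ : ℤ → ℤ
    w⁻¹ = proj₁ (proj₁ w-affine)

    w⁻¹∘w : ∀ m → w⁻¹ (w m) ≡ m
    w⁻¹∘w = proj₁ (proj₂ (proj₁ w-affine))

    periodic : ∀ m → w (m +ℤ + k) ≡ w m +ℤ + k
    periodic = proj₂ w-affine

    periodic-multiple : (t : ℕ) (m : ℤ) → w (m +ℤ + (t * k)) ≡ w m +ℤ + (t * k)
    periodic-multiple zero m = trans (cong w (IntP.+-identityʳ m)) (sym (IntP.+-identityʳ (w m)))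
    periodic-multiple (suc t) m = begin
      w (m +ℤ + (k + t * k))              ≡⟨ cong w (shift-split m) ⟩
      w ((m +ℤ + (t * k)) +ℤ + k)         ≡⟨ periodic (m +ℤ + (t * k)) ⟩
      w (m +ℤ + (t * k)) +ℤ + k           ≡⟨ cong (_+ℤ + k) (periodic-multiple t m) ⟩
      w m +ℤ + (t * k) +ℤ + k             ≡⟨ sym (shift-split (w m)) ⟩
      w m +ℤ + (k + t * k) ∎
      where
      open ≡-Reasoning
      shift-split : ∀ x → x +ℤ + (k + t * k) ≡ (x +ℤ + (t * k)) +ℤ + k
      shift-split x = trans (cong (x +ℤ_) (trans (IntP.pos-+ k (t * k)) (IntP.+-comm (+ k) (+ (t * k)))))
                            (sym (IntP.+-assoc x (+ (t * k)) (+ k)))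

    no-shift : ∀ (i j : Fin k) (t : ℕ) → w (+ toℕ i) ≡ w (+ toℕ j) +ℤ + (t * k) → i ≡ j
    no-shift i j t e = toℕ-injective (no-wrap t i≡j+tk)
      where
      i≡j+tk : toℕ i ≡ toℕ j + t * k
      i≡j+tk = IntP.+-injective (trans (sym (w⁻¹∘w (+ toℕ i)))
                 (trans (cong w⁻¹ (trans e (sym (periodic-multiple t (+ toℕ j)))))
                        (trans (w⁻¹∘w _) (sym (IntP.pos-+ (toℕ j) (t * k))))))
      no-wrap : ∀ t → toℕ i ≡ toℕ j + t * k → toℕ i ≡ toℕ j
      no-wrap zero e′ = trans e′ (+-identityʳ (toℕ j))
      no-wrap (suc t) e′ = ⊥-elim (<⇒≱ (toℕ<n i) (subst (k ≤_) (sym e′)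
                              (≤-trans (m≤m+n k (t * k)) (m≤n+m (k + t * k) (toℕ j)))))

    residue : Fin k → Fin k
    residue i = fromℕ< (n%ℕd<d (w (+ toℕ i)) k)

    residue-inj : Inj residue
    residue-inj i j same-residue = by-quotient-difference (qa - qb) refl
      where
      open ≡-Reasoning
      a b qa qb : ℤ
      a = w (+ toℕ i)
      b = w (+ toℕ j)
      qa = a /ℕ k
      qb = b /ℕ k
      same-remainder : a %ℕ k ≡ b %ℕ k
      same-remainder = trans (sym (toℕ-fromℕ< (n%ℕd<d a k)))
                             (trans (cong toℕ same-residue) (toℕ-fromℕ< (n%ℕd<d b k)))
      regroup : ∀ (r x y K : ℤ) → r +ℤ x *ℤ K ≡ (r +ℤ y *ℤ K) +ℤ (x - y) *ℤ K
      regroup = IntRing.solve-∀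
      undo : ∀ (y d K : ℤ) → y ≡ (y +ℤ d *ℤ K) +ℤ (- d) *ℤ K
      undo = IntRing.solve-∀
      a≡b+dk : a ≡ b +ℤ (qa - qb) *ℤ + k
      a≡b+dk = begin
        a                                          ≡⟨ a≡a%ℕn+[a/ℕn]*n a k ⟩
        + (a %ℕ k) +ℤ qa *ℤ + k                      ≡⟨ cong (λ r → + r +ℤ qa *ℤ + k) same-remainder ⟩
        + (b %ℕ k) +ℤ qa *ℤ + k                      ≡⟨ regroup (+ (b %ℕ k)) qa qb (+ k) ⟩
        (+ (b %ℕ k) +ℤ qb *ℤ + k) +ℤ (qa - qb) *ℤ + k  ≡⟨ cong (_+ℤ (qa - qb) *ℤ + k) (sym (a≡a%ℕn+[a/ℕn]*n b k)) ⟩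
        b +ℤ (qa - qb) *ℤ + k ∎
      by-quotient-difference : (d : ℤ) → qa - qb ≡ d → i ≡ j
      by-quotient-difference (+ t) d≡ =
        no-shift i j t (trans a≡b+dk (cong (b +ℤ_) (trans (cong (_*ℤ + k) d≡) (sym (IntP.pos-* t k)))))
      by-quotient-difference -[1+ t ] d≡ = sym (no-shift j i (suc t) (begin
        b                                   ≡⟨ undo b (qa - qb) (+ k) ⟩
        (b +ℤ (qa - qb) *ℤ + k) +ℤ (- (qa - qb)) *ℤ + k ≡⟨ cong₂ (λ x d → x +ℤ (- d) *ℤ + k) (sym a≡b+dk) d≡ ⟩
        a +ℤ + suc t *ℤ + k                   ≡⟨ cong (a +ℤ_) (sym (IntP.pos-* (suc t) k)) ⟩
        a +ℤ + (suc t * k) ∎))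

  orbit-permutation : (k n : ℕ) .{{_ : NonZero k}} .{{_ : NonZero n}} (nu nuc : Vecℕ k) → InOrbit k n nu nuc →
    Σ (Fin k → Fin k) λ π → Inj π × (∀ i → nuc i % n ≡ nu (π i) % n)
  orbit-permutation k n nu nuc (w , w-affine , on-orbit) =
    residue k w w-affine , residue-inj k w w-affine ,
    λ i → ≡-mod-from-ℤ (nuc i) (nu (residue k w w-affine i)) n (w (+ toℕ i) /ℕ k) (on-orbit i)

residue-injective : (n' a c : ℕ) → 0 < a → a ≤ suc n' → 0 < c → c ≤ suc n' → a % suc n' ≡ c % suc n' → a ≡ c
residue-injective n' a c 0<a a≤n 0<c c≤n same with m≤n⇒m<n∨m≡n a≤n | m≤n⇒m<n∨m≡n c≤n
... | inj₁ a<n | inj₁ c<n = trans (sym (m<n⇒m%n≡m a<n)) (trans same (m<n⇒m%n≡m c<n))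
... | inj₂ refl | inj₂ refl = refl
... | inj₁ a<n | inj₂ refl = ⊥-elim (<⇒≢ 0<a (sym (trans (sym (m<n⇒m%n≡m a<n)) (trans same (n%n≡0 (suc n'))))))
... | inj₂ refl | inj₁ c<n = ⊥-elim (<⇒≢ 0<c (sym (trans (sym (m<n⇒m%n≡m c<n)) (trans (sym same) (n%n≡0 (suc n'))))))

-- Since the entries of ν̌ lie in [1, n] and ν̌ ≡ ν∘π (mod n), the multiplicity of c in ν̌
-- is the number of entries of ν in the residue class of c.
class-multiplicity : {k : ℕ} (n' : ℕ) (nu nuc : Fin k → ℕ) (π : Fin k → Fin k) → Inj π →
  (∀ i → nuc i % suc n' ≡ nu (π i) % suc n') → (∀ x → 0 < nuc x × nuc x ≤ suc n') →
  ∀ c → 0 < c → c ≤ suc n' → mult c nuc ≡ occ ((_% suc n') ∘ nu) (c % suc n')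
class-multiplicity {k} n' nu nuc π π-inj residues in-range c 0<c c≤n = begin
  mult c nuc                                                ≡⟨ mult≡occ c nuc ⟩
  ∑ (λ x → 𝟙 (nuc x ≡ᵇ c)) (allFin k)                       ≡⟨ ∑-cong′ (allFin k) (λ x → cong 𝟙 (same-test x)) ⟩
  ∑ (λ x → 𝟙 (nu (π x) % n ≡ᵇ c % n)) (allFin k)            ≡⟨ ∑-reindex π π-inj (λ y → 𝟙 (nu y % n ≡ᵇ c % n)) ⟩
  occ ((_% n) ∘ nu) (c % n) ∎
  where
  open ≡-Reasoning
  n : ℕ
  n = suc n'
  same-test : ∀ x → (nuc x ≡ᵇ c) ≡ (nu (π x) % n ≡ᵇ c % n)
  same-test x = T-ext _ _
    (λ t → ≡ᵇ-complete (trans (sym (residues x)) (cong (_% n) (≡ᵇ-sound {nuc x} {c} t))))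
    (λ t → ≡ᵇ-complete (residue-injective n' (nuc x) c (proj₁ (in-range x)) (proj₂ (in-range x)) 0<c c≤n
                          (trans (residues x) (≡ᵇ-sound {nu (π x) % n} {c % n} t))))

mainTheorem6 : (k n : ℕ) → .{{_ : NonZero k}} → .{{_ : NonZero n}} →
    (lam mu nu nuc : Vecℕ k) →
    InA k n lam → InA k n mu → InPplus k nu →
    InA k n nuc → InOrbit k n nu nuc →
    N k n lam mu nu ≡ rhs k n lam mu nu nuc
mainTheorem6 k n@(suc n') lam mu nu nuc _ _ nu-dec (nuc-dec , nuc-range) orbit =
  trans (*-cancelʳ-≡ (N k n lam mu nu) (N k n lam mu nuc * M) (stabOrder nu) {{>-nonZero (stabOrder-positive nu)}} scaled)
        (sym (*-assoc (N k n lam mu nuc) _ _))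
  where
  open CongruenceCount {k} {n} lam mu
  open StabiliserRatio n' nu nuc using (M; stabOrder-ratio)
  π-data : Σ (Fin k → Fin k) λ π → Inj π × (∀ i → nuc i % n ≡ nu (π i) % n)
  π-data = AffineOrbit.orbit-permutation k n nu nuc orbit
  π : Fin k → Fin k
  π = proj₁ π-data
  π-inj : Inj π
  π-inj = proj₁ (proj₂ π-data)
  residues : ∀ i → nuc i % n ≡ nu (π i) % n
  residues = proj₂ (proj₂ π-data)
  scaled : N k n lam mu nu * stabOrder nu ≡ N k n lam mu nuc * M * stabOrder nu
  scaled = begin
    N k n lam mu nu * stabOrder nu        ≡⟨ N-times-stabOrder nu nu-dec ⟩
    pairCount nu                          ≡⟨ pairCount-invariant nu nuc π π-inj residues ⟩
    pairCount nuc                         ≡⟨ sym (N-times-stabOrder nuc nuc-dec) ⟩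
    N k n lam mu nuc * stabOrder nuc      ≡⟨ cong (N k n lam mu nuc *_) (stabOrder-ratio nuc-range
                                               (class-multiplicity n' nu nuc π π-inj residues nuc-range)) ⟩
    N k n lam mu nuc * (M * stabOrder nu) ≡⟨ sym (*-assoc (N k n lam mu nuc) M (stabOrder nu)) ⟩
    N k n lam mu nuc * M * stabOrder nu ∎
    where open ≡-Reasoning
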